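{- Let $h$, $k$, and $i$ be positive integers satisfying $k \in O(n^{1/h})$. In an $n$-node weighted directed graph $G$, each node $u$ can deterministically compute the $h^i$-hop distances from $u$ to all nodes in $N_k^{h^i}(u)$, in $O(i)$ rounds of the Congested-Clique model.
   Context: Congested-Clique model: there are $n$ nodes with distinct identifiers in $\{1,\dots,n\}$, communicating in synchronous rounds over a complete communication network; in each round every node may send a (possibly different) message of $O(\log n)$ bits to every other node, and local computation is free. The input graph $G$ is on these $n$ nodes; initially each node knows its incident edges and their weights; edge weights are polynomially bounded positive integers. The number of hops of a path is its number of edges. The $r$-hop distance from $u$ to $v$ is the minimum length (total weight) of a directed path from $u$ to $v$ with at most $r$ hops. $N_k^{r}(u)$ is the set of the $k$ nodes $v$ with the smallest $r$-hop distances from $u$, breaking ties by identifiers. -}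

module Defs where

open import Data.Nat using (ℕ; zero; suc; _+_; _*_; _^_; _≤_; _<_; _<ᵇ_; _≡ᵇ_)
open import Data.Nat.Logarithm using (⌈log₂_⌉)
open import Data.Bool using (Bool; true; false; _∧_; _∨_; T)
open import Data.Fin using (Fin; toℕ)
open import Data.Maybe using (Maybe; just; nothing)
open import Data.List using (List; []; _∷_; length; filter)
open import Data.List.Base using (allFin)
open import Data.Product using (_×_; _,_; Σ; ∃)
open import Data.Sum using (_⊎_)
open import Data.Empty using (⊥)
open import Relation.Nullary using (¬_)
open import Relation.Nullary.Decidable using (T?)
open import Relation.Binary.PropositionalEquality using (_≡_)

-- Weighted directed graphs on the node set Fin n (identifiers 1..n are
-- represented by Fin n).  W u v ≡ just c means there is a directed edge
-- u → v of weight c; nothing means no edge.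

Graph : ℕ → Set
Graph n = Fin n → Fin n → Maybe ℕ

PolyWeights : ∀ {n} → ℕ → Graph n → Set
PolyWeights {n} d W = ∀ u v c → W u v ≡ just c → (1 ≤ c) × (c ≤ n ^ d)

-- Directed walks: Walk W u v h l = a walk from u to v with h hops and
-- total weight (length) l.
data Walk {n} (W : Graph n) : Fin n → Fin n → ℕ → ℕ → Set where
  [] : ∀ {u} → Walk W u u 0 0
  step : ∀ {u w v h l c} → W u w ≡ just c → Walk W w v h l →
         Walk W u v (suc h) (c + l)

-- Extended (possibly infinite) distances: nothing = ∞.
IsHopDist : ∀ {n} → Graph n → ℕ → Fin n → Fin n → Maybe ℕ → Set
IsHopDist W r u v nothing = ∀ h l → h ≤ r → ¬ Walk W u v h l
IsHopDist W r u v (just m) =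
  (∃ λ h → h ≤ r × Walk W u v h m) ×
  (∀ h l → h ≤ r → Walk W u v h l → m ≤ l)

ltDist : Maybe ℕ → Maybe ℕ → Bool
ltDist (just a) (just b) = a <ᵇ b
ltDist (just a) nothing  = true
ltDist nothing  _        = false

eqDist : Maybe ℕ → Maybe ℕ → Bool
eqDist (just a) (just b) = a ≡ᵇ b
eqDist nothing  nothing  = true
eqDist _        _        = false

precedes : ∀ {n} → Maybe ℕ → Fin n → Maybe ℕ → Fin n → Bool
precedes a w b v = ltDist a b ∨ (eqDist a b ∧ (toℕ w <ᵇ toℕ v))

-- Given the r-hop distances D from u to all nodes, v ∈ N_k^r(u) iff fewer
-- than k nodes come strictly before v in the (distance, id) order.
-- (This selects exactly the k nodes with smallest r-hop distance,
-- ties broken by identifiers; all nodes if k ≥ n.)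
InNearest : ∀ {n} → ℕ → (Fin n → Maybe ℕ) → Fin n → Set
InNearest {n} k D v =
  length (filter (λ w → T? (precedes (D w) w (D v) v)) (allFin n)) < k

Msg : Set
Msg = List Bool

Input : ℕ → Set
Input n = (Fin n → Maybe ℕ) × (Fin n → Maybe ℕ)

input : ∀ {n} → Graph n → Fin n → Input n
input W u = (λ v → W u v) , (λ v → W v u)

-- History of a node: list of received rounds (most recent first); in each
-- round, the message received from every node.
History : ℕ → Set
History n = List (Fin n → Msg)

-- Local computation is free: a node's
-- messages and output are arbitrary functions of its identifier, its
-- local input and everything it has received.
record Protocol (n : ℕ) : Set where
  field
    send   : Fin n → Input n → History n → Fin n → Msg
    output : Fin n → Input n → History n → (Fin n → Bool) × (Fin n → Maybe ℕ)
open Protocol public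

run : ∀ {n} → Protocol n → Graph n → ℕ → Fin n → History n
run P W zero    u = []
run P W (suc t) u =
  (λ v → send P v (input W v) (run P W t v) u) ∷ run P W t u

Bandwidth : ∀ {n} → ℕ → Protocol n → Graph n → ℕ → Set
Bandwidth {n} b P W R = ∀ t u v → t < R →
  length (send P u (input W u) (run P W t u) v) ≤ b * ⌈log₂ n ⌉

outputAt : ∀ {n} → Protocol n → Graph n → ℕ → Fin n → (Fin n → Bool) × (Fin n → Maybe ℕ)
outputAt P W R u = output P u (input W u) (run P W R u)

CorrectNearest : ∀ {n} → Graph n → ℕ → ℕ → Fin n → (Fin n → Bool) × (Fin n → Maybe ℕ) → Set
CorrectNearest {n} W r k u (S , out) =
  Σ (Fin n → Maybe ℕ) λ D →
    (∀ v → IsHopDist W r u v (D v)) ×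
    (∀ v → (S v ≡ true → InNearest k D v) × (InNearest k D v → S v ≡ true)) ×
    (∀ v → InNearest k D v → out v ≡ D v)

-- A deterministic algorithm: a protocol for every n and parameters h k i
-- (the parameters are known to all nodes).
Algorithm : Set
Algorithm = (n h k i : ℕ) → Protocol n

-- Node u keeps two nearest sets with distances, N_k^a(u) ("cur") and N_k^b(u) ("base"). If v ∈ N_k^(a+b)(u),
-- a shortest (a+b)-hop walk to v splits at a node w with w ∈ N_k^a(u) and v ∈ N_k^b(w), and removing hops only
-- raises distances, so the min-plus product of u's cur list with the base lists of its members yields N_k^(a+b)(u)
-- exactly. The at most k² triples reach u in two rounds through relays: with B = 2C + 1 and g = ⌊k/B⌋ + 1 we have
-- k ≤ gB, and k^h ≤ Cn with h ≥ 2 gives g² ≤ n, so a relay for every pair of B-blocks exists and each message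
-- carries O(B²) fields of O(log n) bits. Starting from 1-hop knowledge, every h - 1 phases multiply the base
-- radius by h, so (h - 1) i phases of two rounds reach radius h^i.

module Submission where

open import Defs

open import Data.Nat using (ℕ; zero; suc; _+_; _*_; _^_; _≤_; _<_; _⊓_; z≤n; s≤s; _∸_; _<?_; _≤?_; NonZero; >-nonZero; _<ᵇ_; _≡ᵇ_; z<s; ⌈_/2⌉)
open import Data.Nat.Induction using (<-rec)
open import Data.Nat.Solver using (module +-*-Solver)
open +-*-Solver using (solve; _:+_; _:*_; _:=_)
open import Data.Nat.DivMod using (_/_; _%_; m/n*n≤m; m≡m%n+[m/n]*n; m%n<n; m<n*o⇒m/o<n; [m+kn]%n≡m%n; m<n⇒m%n≡m; +-distrib-/; m<n⇒m/n≡0; m*n/n≡m; m*n%n≡0)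
open import Data.Nat.Logarithm using (⌈log₂_⌉; ⌈log₂⌉-mono-≤; ⌈log₂⌈n/2⌉⌉≡⌈log₂n⌉∸1)
open import Data.Nat.Properties
open import Data.Fin using (Fin; toℕ; fromℕ<) renaming (zero to fz; suc to fs)
open import Data.Fin.Properties using (pigeonhole; toℕ-injective; fromℕ<-toℕ; toℕ-fromℕ<; toℕ<n) renaming (_≟_ to _≟ᶠ_)
open import Data.Maybe using (Maybe; just; nothing; maybe′)
open import Data.List using (List; []; _∷_; _++_; allFin; length; filter; take; drop; concatMap; upTo)
open import Data.List.Properties using (length-++; length-take)
open import Data.List.Relation.Unary.All using () renaming (lookup to lookupAll)
open import Data.List.Relation.Unary.AllPairs using (_∷_)
open import Data.List.Relation.Unary.Unique.Propositional using (Unique)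
open import Data.List.Relation.Unary.Unique.Propositional.Properties using (allFin⁺)
open import Data.List.Membership.Propositional using (_∈_; find; lose)
open import Data.List.Membership.Propositional.Properties using (∈-allFin; ∈-filter⁻; ∈-filter⁺; ∈-concatMap⁺; ∈-concatMap⁻; ∈-upTo⁺; ∈-upTo⁻)
open import Data.List.Relation.Unary.Any using (here; there)
open import Data.Product using (_×_; _,_; ∃; ∃₂; proj₁; proj₂)
open import Data.Sum using (_⊎_; inj₁; inj₂)
open import Data.Empty using (⊥-elim)
open import Relation.Nullary using (¬_; yes; no; Dec)
open import Relation.Nullary.Decidable using (T?; ¬?)
open import Relation.Unary using (Decidable)
open import Relation.Nullary.Construct.Add.Supremum using (_⁺)
import Relation.Binary.Construct.Add.Supremum.NonStrict as AddSupNonStrict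
import Relation.Binary.Construct.Add.Supremum.Strict as AddSupStrict
open import Data.Bool using (Bool; true; false; T; if_then_else_)
open import Data.Bool.Properties using (T-∨; T-∧; T-≡)
open import Function.Bundles using (Equivalence)
open import Function using (_∘_; flip; id)
open import Data.Product.Relation.Binary.Lex.Strict using (×-Lex; ×-transitive; ×-irreflexive; ×-compare)
open import Relation.Binary.Definitions using (tri<; tri≈; tri>)
open import Relation.Binary.PropositionalEquality using (_≡_; _≢_; refl; sym; trans; cong; cong₂; subst; subst₂; isEquivalence; module ≡-Reasoning)

-- ℕ ⁺ is Maybe ℕ with nothing as the added top element, matching the encoding of ∞ in IsHopDist.
ℕ∞ : Set
ℕ∞ = ℕ ⁺

open AddSupNonStrict _≤_ using ([_]; _≤⊤⁺; [≤]-injective) renaming (_≤⁺_ to _≤∞_)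
open AddSupStrict _<_ using ([_]; [_]<⊤⁺) renaming (_<⁺_ to _<∞_)

infixl 6 _+∞_ _⊓∞_

_+∞_ : ℕ∞ → ℕ∞ → ℕ∞
just a +∞ just b = just (a + b)
_      +∞ _      = nothing

_⊓∞_ : ℕ∞ → ℕ∞ → ℕ∞
nothing ⊓∞ y       = y
just a  ⊓∞ nothing = just a
just a  ⊓∞ just b  = just (a ⊓ b)

≤∞-reflexive : ∀ {x y} → x ≡ y → x ≤∞ y
≤∞-reflexive = AddSupNonStrict.≤⁺-reflexive-≡ _≤_ ≤-reflexive

≤∞-refl : ∀ {x} → x ≤∞ x
≤∞-refl = ≤∞-reflexive refl

≤∞-trans : ∀ {x y z} → x ≤∞ y → y ≤∞ z → x ≤∞ z
≤∞-trans = AddSupNonStrict.≤⁺-trans _≤_ ≤-trans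

≤∞-antisym : ∀ {x y} → x ≤∞ y → y ≤∞ x → x ≡ y
≤∞-antisym = AddSupNonStrict.≤⁺-antisym-≡ _≤_ ≤-antisym

<∞-trans : ∀ {x y z} → x <∞ y → y <∞ z → x <∞ z
<∞-trans = AddSupStrict.<⁺-trans _<_ <-trans

≤-<∞-trans : ∀ {x y z} → x ≤∞ y → y <∞ z → x <∞ z
≤-<∞-trans = AddSupStrict.<⁺-transʳ _<_ ≤-<-trans

<-≤∞-trans : ∀ {x y z} → x <∞ y → y ≤∞ z → x <∞ z
<-≤∞-trans = AddSupStrict.<⁺-transˡ _<_ <-≤-trans

<∞-irrefl : ∀ {x} → ¬ x <∞ x
<∞-irrefl = AddSupStrict.<⁺-irrefl-≡ _<_ <-irrefl refl

<∞⇒≤∞ : ∀ {x y} → x <∞ y → x ≤∞ y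
<∞⇒≤∞ [ p ]      = [ <⇒≤ p ]
<∞⇒≤∞ [ a ]<⊤⁺   = just a ≤⊤⁺

≤∞⇒<∞⊎≡ : ∀ {x y} → x ≤∞ y → x <∞ y ⊎ x ≡ y
≤∞⇒<∞⊎≡ [ p ] with m≤n⇒m<n∨m≡n p
... | inj₁ q    = inj₁ [ q ]
... | inj₂ refl = inj₂ refl
≤∞⇒<∞⊎≡ (just a  ≤⊤⁺) = inj₁ [ a ]<⊤⁺
≤∞⇒<∞⊎≡ (nothing ≤⊤⁺) = inj₂ refl

⊓∞-≤ˡ : ∀ x y → x ⊓∞ y ≤∞ x
⊓∞-≤ˡ nothing  y        = y ≤⊤⁺
⊓∞-≤ˡ (just a) nothing  = ≤∞-refl
⊓∞-≤ˡ (just a) (just b) = [ m⊓n≤m a b ]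

⊓∞-≤ʳ : ∀ x y → x ⊓∞ y ≤∞ y
⊓∞-≤ʳ nothing  y        = ≤∞-refl
⊓∞-≤ʳ (just a) nothing  = just a ≤⊤⁺
⊓∞-≤ʳ (just a) (just b) = [ m⊓n≤n a b ]

⊓∞-glb : ∀ {z x y} → z ≤∞ x → z ≤∞ y → z ≤∞ x ⊓∞ y
⊓∞-glb (_ ≤⊤⁺) q       = q
⊓∞-glb [ p ]   (_ ≤⊤⁺) = [ p ]
⊓∞-glb [ p ]   [ q ]   = [ ⊓-glb p q ]

⊓∞-sel : ∀ x y → x ⊓∞ y ≡ x ⊎ x ⊓∞ y ≡ y
⊓∞-sel nothing  y        = inj₂ refl
⊓∞-sel (just a) nothing  = inj₁ refl
⊓∞-sel (just a) (just b) with ⊓-sel a b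
... | inj₁ e = inj₁ (cong just e)
... | inj₂ e = inj₂ (cong just e)

+∞-mono-≤∞ : ∀ {a b c d} → a ≤∞ b → c ≤∞ d → a +∞ c ≤∞ b +∞ d
+∞-mono-≤∞ {b = nothing} p q = _ ≤⊤⁺
+∞-mono-≤∞ {b = just b} {d = nothing} p q = _ ≤⊤⁺
+∞-mono-≤∞ [ p ] [ q ] = [ +-mono-≤ p q ]

+∞-identityʳ : ∀ x → x +∞ just 0 ≡ x
+∞-identityʳ nothing  = refl
+∞-identityʳ (just a) = cong just (+-identityʳ a)

+∞≡justˡ : ∀ {x y m} → x +∞ y ≡ just m → ∃ λ a → x ≡ just a
+∞≡justˡ {just a} {just b} refl = a , refl

+∞≡just : ∀ {x y m} → x +∞ y ≡ just m → ∃₂ λ a b → x ≡ just a × y ≡ just b × a + b ≡ m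
+∞≡just {just a} {just b} refl = a , b , refl , refl , refl

minOver : {A : Set} → List A → (A → ℕ∞) → ℕ∞
minOver []       f = nothing
minOver (x ∷ xs) f = f x ⊓∞ minOver xs f

minOver-≤ : {A : Set} (xs : List A) (f : A → ℕ∞) {x : A} → x ∈ xs → minOver xs f ≤∞ f x
minOver-≤ (y ∷ xs) f (here refl) = ⊓∞-≤ˡ (f y) _
minOver-≤ (y ∷ xs) f (there p)   = ≤∞-trans (⊓∞-≤ʳ (f y) _) (minOver-≤ xs f p)

≤-minOver : {A : Set} (xs : List A) (f : A → ℕ∞) {z : ℕ∞} → (∀ x → x ∈ xs → z ≤∞ f x) → z ≤∞ minOver xs f
≤-minOver []       f h = _ ≤⊤⁺
≤-minOver (y ∷ xs) f h = ⊓∞-glb (h y (here refl)) (≤-minOver xs f (λ x p → h x (there p)))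

minOver-attained : {A : Set} (xs : List A) (f : A → ℕ∞) {m : ℕ} →
                   minOver xs f ≡ just m → ∃ λ x → x ∈ xs × f x ≡ just m
minOver-attained (y ∷ xs) f e with ⊓∞-sel (f y) (minOver xs f)
... | inj₁ e₁ = y , here refl , trans (sym e₁) e
... | inj₂ e₂ with minOver-attained xs f (trans (sym e₂) e)
... | x , p , q = x , there p , q

-- Hop distances

dist₀ : ∀ {n} → Fin n → Fin n → ℕ∞
dist₀ u v with u ≟ᶠ v
... | yes _ = just 0
... | no  _ = nothing

dist₀-refl : ∀ {n} (u : Fin n) → dist₀ u u ≡ just 0
dist₀-refl u with u ≟ᶠ u
... | yes _ = refl
... | no u≢u = ⊥-elim (u≢u refl)

dist₀≡just : ∀ {n} {u v : Fin n} {m} → dist₀ u v ≡ just m → u ≡ v × m ≡ 0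
dist₀≡just {u = u} {v} e with u ≟ᶠ v
dist₀≡just refl | yes u≡v = u≡v , refl

relax : ∀ {n} → (Fin n → ℕ∞) → (Fin n → Fin n → ℕ∞) → Fin n → Fin n → ℕ∞
relax {n} row D u v = dist₀ u v ⊓∞ minOver (allFin n) (λ w → row w +∞ D w v)

hopDist : ∀ {n} → Graph n → ℕ → Fin n → Fin n → ℕ∞
hopDist W zero    = dist₀
hopDist W (suc r) u = relax (W u) (hopDist W r) u

module _ {n} (W : Graph n) where

  hopDist-sound : ∀ r u v {m} → hopDist W r u v ≡ just m → ∃ λ h → h ≤ r × Walk W u v h m
  hopDist-sound zero u v e with dist₀≡just e
  ... | refl , refl = 0 , z≤n , []
  hopDist-sound (suc r) u v e with ⊓∞-sel (dist₀ u v) (minOver (allFin n) (λ w → W u w +∞ hopDist W r w v))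
  ... | inj₁ e₀ with dist₀≡just (trans (sym e₀) e)
  ... | refl , refl = 0 , z≤n , []
  hopDist-sound (suc r) u v e | inj₂ e₁ with minOver-attained (allFin n) _ (trans (sym e₁) e)
  ... | w , _ , e₂ with +∞≡just {W u w} e₂
  ... | c , l , eᵤ , eₗ , refl with hopDist-sound r w v eₗ
  ... | h , h≤r , walk = suc h , s≤s h≤r , step eᵤ walk

  hopDist-≤-walk : ∀ {r u v h l} → h ≤ r → Walk W u v h l → hopDist W r u v ≤∞ just l
  hopDist-≤-walk {zero}  {u} z≤n [] = ≤∞-reflexive (dist₀-refl u)
  hopDist-≤-walk {suc r} {u} z≤n [] = ≤∞-trans (⊓∞-≤ˡ (dist₀ u u) _) (≤∞-reflexive (dist₀-refl u))
  hopDist-≤-walk {suc r} {u} {v} (s≤s h≤r) (step {w = w} {c = c} e walk) =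
    ≤∞-trans (⊓∞-≤ʳ (dist₀ u v) _)
      (≤∞-trans (minOver-≤ (allFin n) (λ w → W u w +∞ hopDist W r w v) (∈-allFin w))
        (+∞-mono-≤∞ (≤∞-reflexive e) (hopDist-≤-walk h≤r walk)))

  hopDist-correct : ∀ r u v → IsHopDist W r u v (hopDist W r u v)
  hopDist-correct r u v with hopDist W r u v in e
  ... | nothing = λ h l h≤r walk → noWalk (subst (_≤∞ just l) e (hopDist-≤-walk h≤r walk))
    where
      noWalk : ∀ {l} → ¬ nothing ≤∞ just l
      noWalk ()
  ... | just m = hopDist-sound r u v e ,
                 λ h l h≤r walk → [≤]-injective (subst (_≤∞ just l) e (hopDist-≤-walk h≤r walk))

  _++ʷ_ : ∀ {u x v h₁ h₂ l₁ l₂} → Walk W u x h₁ l₁ → Walk W x v h₂ l₂ → Walk W u v (h₁ + h₂) (l₁ + l₂)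
  []                               ++ʷ q = q
  step {l = l} {c = c} e p ++ʷ q = subst (Walk W _ _ _) (sym (+-assoc c l _)) (step e (p ++ʷ q))

  splitWalk : ∀ {u v h l} → Walk W u v h l → (a : ℕ) → a < h →
              ∃ λ w → ∃₂ λ l₁ l₂ → Walk W u w a l₁ × Walk W w v (h ∸ a) l₂ × l₁ + l₂ ≡ l
  splitWalk {u} p zero _ = u , 0 , _ , [] , p , refl
  splitWalk (step {c = c} e p) (suc a) (s≤s a<h) with splitWalk p a a<h
  ... | w , l₁ , l₂ , p₁ , p₂ , eq = w , c + l₁ , l₂ , step e p₁ , p₂ , trans (+-assoc c l₁ l₂) (cong (c +_) eq)

  hopDist-triangle : ∀ a b u w v → hopDist W (a + b) u v ≤∞ hopDist W a u w +∞ hopDist W b w v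
  hopDist-triangle a b u w v with hopDist W a u w in e₁ | hopDist W b w v in e₂
  ... | nothing | _       = _ ≤⊤⁺
  ... | just x  | nothing = _ ≤⊤⁺
  ... | just x  | just y with hopDist-sound a u w e₁ | hopDist-sound b w v e₂
  ... | h₁ , h₁≤a , p₁ | h₂ , h₂≤b , p₂ = hopDist-≤-walk (+-mono-≤ h₁≤a h₂≤b) (p₁ ++ʷ p₂)

  hopDist-refl : ∀ r v → hopDist W r v v ≡ just 0
  hopDist-refl r v with hopDist W r v v | hopDist-≤-walk {r} z≤n ([] {u = v})
  ... | just m | [ m≤0 ] = cong just (n≤0⇒n≡0 m≤0)

  hopDist-mono : ∀ a b u v → hopDist W (a + b) u v ≤∞ hopDist W a u v
  hopDist-mono a b u v =
    subst (hopDist W (a + b) u v ≤∞_)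
      (trans (cong (hopDist W a u v +∞_) (hopDist-refl b v)) (+∞-identityʳ _))
      (hopDist-triangle a b u v v)

  vertexAt : ∀ {u v h l} → Walk W u v h l → Fin (suc h) → Fin n
  vertexAt {u} p        fz     = u
  vertexAt (step e p) (fs i) = vertexAt p i

  suffixFrom : ∀ {u v h l} (p : Walk W u v h l) (j : Fin (suc h)) →
               ∃ λ l' → l' ≤ l × Walk W (vertexAt p j) v (h ∸ toℕ j) l'
  suffixFrom p fz = _ , ≤-refl , p
  suffixFrom (step {c = c} e p) (fs j) with suffixFrom p j
  ... | l' , l'≤l , q = l' , ≤-trans l'≤l (m≤n+m _ c) , q

  shortcut : ∀ {u v h l} (p : Walk W u v h l) (i j : Fin (suc h)) → toℕ i < toℕ j → vertexAt p i ≡ vertexAt p j →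
             ∃₂ λ h' l' → h' < h × l' ≤ l × Walk W u v h' l'
  shortcut (step e p) fz (fs j) _ eq with suffixFrom p j
  ... | l' , l'≤l , q = _ , l' , s≤s (m∸n≤m _ (toℕ j)) , ≤-trans l'≤l (m≤n+m _ _) , subst (λ x → Walk W x _ _ l') (sym eq) q
  shortcut (step {c = c} e p) (fs i) (fs j) (s≤s i<j) eq with shortcut p i j i<j eq
  ... | h' , l' , h'<h , l'≤l , q = suc h' , c + l' , s≤s h'<h , +-monoʳ-≤ c l'≤l , step e q

  shortWalk : ∀ {u v h l} → Walk W u v h l → ∃₂ λ h' l' → h' < n × h' ≤ h × l' ≤ l × Walk W u v h' l'
  shortWalk = go (suc _) ≤-refl
    where
      go : ∀ fuel {u v h l} → h < fuel → Walk W u v h l → ∃₂ λ h' l' → h' < n × h' ≤ h × l' ≤ l × Walk W u v h' l'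
      go fuel {h = h} _ p with h <? n
      ... | yes h<n = h , _ , h<n , ≤-refl , ≤-refl , p
      go (suc fuel) (s≤s h≤fuel) p | no h≮n with pigeonhole (s≤s (≮⇒≥ h≮n)) (vertexAt p)
      ... | i , j , i<j , eq with shortcut p i j i<j eq
      ... | h' , l' , h'<h , l'≤l , q with go fuel (<-≤-trans h'<h h≤fuel) q
      ... | h'' , l'' , h''<n , h''≤h' , l''≤l' , q' =
        h'' , l'' , h''<n , ≤-trans h''≤h' (<⇒≤ h'<h) , ≤-trans l''≤l' l'≤l , q'

  module _ {d : ℕ} (pw : PolyWeights d W) where

    walk-length-pos : ∀ {u v h l} → Walk W u v h l → 0 < h → 1 ≤ l
    walk-length-pos (step {c = c} e _) _ = ≤-trans (proj₁ (pw _ _ c e)) (m≤m+n c _)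

    walk-length-≤ : ∀ {u v h l} → Walk W u v h l → l ≤ h * n ^ d
    walk-length-≤ []                 = z≤n
    walk-length-≤ (step {c = c} e p) = +-mono-≤ (proj₂ (pw _ _ c e)) (walk-length-≤ p)

    hopDist-< : ∀ r u v {m} → hopDist W r u v ≡ just m → m < n ^ suc d
    hopDist-< r u v {m} e with hopDist-sound r u v e
    ... | h , h≤r , p with shortWalk p
    ... | h' , l' , h'<n , h'≤h , l'≤l , q = begin-strict
        m                   ≤⟨ [≤]-injective (subst (_≤∞ just l') e (hopDist-≤-walk (≤-trans h'≤h h≤r) q)) ⟩
        l'                  ≤⟨ walk-length-≤ q ⟩
        h' * n ^ d          <⟨ *-monoˡ-< (n ^ d) h'<n ⟩
        n * n ^ d           ∎
      where
        open ≤-Reasoning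
        instance
          _ : NonZero (n ^ d)
          _ = m^n≢0 n d {{>-nonZero (≤-<-trans z≤n h'<n)}}

-- Nearest sets

Key : Set
Key = ℕ∞ × ℕ

infix 4 _≺_

-- The (distance, identifier) order that Defs.precedes computes.
_≺_ : Key → Key → Set
_≺_ = ×-Lex _≡_ _<∞_ _<_

≺-trans : ∀ {x y z} → x ≺ y → y ≺ z → x ≺ z
≺-trans = ×-transitive {_<₂_ = _<_} isEquivalence (AddSupStrict.<⁺-resp-≡ _<_) <∞-trans <-trans

≺-irrefl : ∀ {x} → ¬ x ≺ x
≺-irrefl = ×-irreflexive {_≈₁_ = _≡_} {_<₁_ = _<∞_} {_≈₂_ = _≡_} {_<₂_ = _<_} (λ { refl → <∞-irrefl }) <-irrefl (refl , refl)

≺-total : ∀ {a b : ℕ∞} {i j} → i ≢ j → (a , i) ≺ (b , j) ⊎ (b , j) ≺ (a , i)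
≺-total {a} {b} {i} {j} i≢j with ×-compare {_<₁_ = _<∞_} {_<₂_ = _<_} sym (AddSupStrict.<⁺-cmp-≡ _<_ <-cmp) <-cmp (a , i) (b , j)
... | tri< lt _ _  = inj₁ lt
... | tri≈ _ eq _  = ⊥-elim (i≢j (proj₂ eq))
... | tri> _ _ gt  = inj₂ gt

≺⇒≤∞ : ∀ {a b i j} → (a , i) ≺ (b , j) → a ≤∞ b
≺⇒≤∞ (inj₁ a<b)        = <∞⇒≤∞ a<b
≺⇒≤∞ (inj₂ (refl , _)) = ≤∞-refl

≺-respˡ-≤∞ : ∀ {a a' b i j} → a ≤∞ a' → (a' , i) ≺ (b , j) → (a , i) ≺ (b , j)
≺-respˡ-≤∞ a≤a' (inj₁ a'<b) = inj₁ (≤-<∞-trans a≤a' a'<b)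
≺-respˡ-≤∞ a≤a' (inj₂ (refl , i<j)) with ≤∞⇒<∞⊎≡ a≤a'
... | inj₁ a<a' = inj₁ a<a'
... | inj₂ refl = inj₂ (refl , i<j)

≺-respʳ-≤∞ : ∀ {a b b' i j} → b ≤∞ b' → (a , i) ≺ (b , j) → (a , i) ≺ (b' , j)
≺-respʳ-≤∞ b≤b' (inj₁ a<b) = inj₁ (<-≤∞-trans a<b b≤b')
≺-respʳ-≤∞ b≤b' (inj₂ (refl , i<j)) with ≤∞⇒<∞⊎≡ b≤b'
... | inj₁ b<b' = inj₁ b<b'
... | inj₂ refl = inj₂ (refl , i<j)

≺-+∞-shift : ∀ c {a b i j} → (a , i) ≺ (b , j) → (just c +∞ a , i) ≺ (just c +∞ b , j)
≺-+∞-shift c (inj₁ [ a<b ])        = inj₁ [ +-monoʳ-< c a<b ]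
≺-+∞-shift c (inj₁ [ a ]<⊤⁺)       = inj₁ [ c + a ]<⊤⁺
≺-+∞-shift c (inj₂ (refl , i<j))   = inj₂ (refl , i<j)

ltDist⇒<∞ : ∀ a b → T (ltDist a b) → a <∞ b
ltDist⇒<∞ (just a) (just b) t = [ <ᵇ⇒< a b t ]
ltDist⇒<∞ (just a) nothing  _ = [ a ]<⊤⁺

<∞⇒ltDist : ∀ {a b} → a <∞ b → T (ltDist a b)
<∞⇒ltDist [ a<b ]   = <⇒<ᵇ a<b
<∞⇒ltDist [ _ ]<⊤⁺  = _

eqDist⇒≡ : ∀ a b → T (eqDist a b) → a ≡ b
eqDist⇒≡ (just a) (just b) t = cong just (≡ᵇ⇒≡ a b t)
eqDist⇒≡ nothing  nothing  _ = refl

eqDist-refl : ∀ a → T (eqDist a a)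
eqDist-refl (just a) = ≡⇒≡ᵇ a a refl
eqDist-refl nothing  = _

precedes⇒≺ : ∀ {n} a (w : Fin n) b v → T (precedes a w b v) → (a , toℕ w) ≺ (b , toℕ v)
precedes⇒≺ a w b v t with Equivalence.to T-∨ t
... | inj₁ lt = inj₁ (ltDist⇒<∞ a b lt)
... | inj₂ eqlt with Equivalence.to T-∧ eqlt
... | eq , lt = inj₂ (eqDist⇒≡ a b eq , <ᵇ⇒< (toℕ w) (toℕ v) lt)

≺⇒precedes : ∀ {n} {a} {w : Fin n} {b v} → (a , toℕ w) ≺ (b , toℕ v) → T (precedes a w b v)
≺⇒precedes (inj₁ a<b)          = Equivalence.from T-∨ (inj₁ (<∞⇒ltDist a<b))
≺⇒precedes {a = a} (inj₂ (refl , i<j)) =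
  Equivalence.from T-∨ (inj₂ (Equivalence.from T-∧ (eqDist-refl a , <⇒<ᵇ i<j)))

module _ {A : Set} where

  count : {P : A → Set} → Decidable P → List A → ℕ
  count P? xs = length (filter P? xs)

  module _ {P Q : A → Set} (P? : Decidable P) (Q? : Decidable Q) where

    count-mono : ∀ xs → (∀ {x} → x ∈ xs → P x → Q x) → count P? xs ≤ count Q? xs
    count-mono []       _ = z≤n
    count-mono (x ∷ xs) h with P? x | Q? x
    ... | no _   | no _   = count-mono xs (h ∘ there)
    ... | no _   | yes _  = m≤n⇒m≤1+n (count-mono xs (h ∘ there))
    ... | yes _  | yes _  = s≤s (count-mono xs (h ∘ there))
    ... | yes px | no ¬qx = ⊥-elim (¬qx (h (here refl) px))

    count-≤-suc : ∀ m xs → Unique xs → (∀ {x} → x ∈ xs → P x → x ≡ m ⊎ Q x) → count P? xs ≤ suc (count Q? xs)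
    count-≤-suc m []       _            _ = z≤n
    count-≤-suc m (x ∷ xs) (x∉xs ∷ uniq) h with P? x | Q? x
    ... | no _   | no _   = count-≤-suc m xs uniq (h ∘ there)
    ... | no _   | yes _  = m≤n⇒m≤1+n (count-≤-suc m xs uniq (h ∘ there))
    ... | yes _  | yes _  = s≤s (count-≤-suc m xs uniq (h ∘ there))
    ... | yes px | no ¬qx = s≤s (count-mono xs onlyQ)
      where
        x≡m : x ≡ m
        x≡m with h (here refl) px
        ... | inj₁ x≡m = x≡m
        ... | inj₂ qx  = ⊥-elim (¬qx qx)
        onlyQ : ∀ {z} → z ∈ xs → P z → Q z
        onlyQ z∈ pz with h (there z∈) pz
        ... | inj₁ refl = ⊥-elim (lookupAll x∉xs z∈ x≡m)
        ... | inj₂ qz   = qz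

  count-pos : {P : A → Set} (P? : Decidable P) (xs : List A) → 0 < count P? xs → ∃ λ x → x ∈ xs × P x
  count-pos P? xs pos with filter P? xs in e
  ... | x ∷ _ = x , ∈-filter⁻ P? (subst (x ∈_) (sym e) (here refl))

  module _ {_<_ : A → A → Set} (<-trans : ∀ {x y z} → x < y → y < z → x < z) (<-irrefl : ∀ {x} → ¬ x < x)
           (_<?_ : ∀ x y → Dec (x < y)) {P : A → Set} (P? : Decidable P) where

    private
      notBelow : ∀ {z m m'} → m' ≡ m ⊎ m' < m → ¬ z < m → ¬ z < m'
      notBelow (inj₁ refl) z≮m = z≮m
      notBelow (inj₂ m'<m) z≮m z<m' = z≮m (<-trans z<m' m'<m)

    minimalBelow : ∀ xs {m} → P m → ∃ λ m' → P m' × (m' ≡ m ⊎ m' < m) × (∀ {z} → z ∈ xs → P z → ¬ z < m')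
    minimalBelow []       {m} pm = m , pm , inj₁ refl , λ ()
    minimalBelow (x ∷ xs) {m} pm with P? x | x <? m
    ... | yes px | yes x<m with minimalBelow xs px
    ...   | m' , pm' , m'≤x , least = m' , pm' , below m'≤x , least'
      where
        below : m' ≡ x ⊎ m' < x → m' ≡ m ⊎ m' < m
        below (inj₁ refl) = inj₂ x<m
        below (inj₂ m'<x) = inj₂ (<-trans m'<x x<m)
        least' : ∀ {z} → z ∈ x ∷ xs → P z → ¬ z < m'
        least' (here refl) _ = notBelow m'≤x <-irrefl
        least' (there z∈)  pz = least z∈ pz
    minimalBelow (x ∷ xs) {m} pm | yes px | no x≮m with minimalBelow xs pm
    ...   | m' , pm' , m'≤m , least = m' , pm' , m'≤m , least'
      where
        least' : ∀ {z} → z ∈ x ∷ xs → P z → ¬ z < m'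
        least' (here refl) _ = notBelow m'≤m x≮m
        least' (there z∈)  pz = least z∈ pz
    minimalBelow (x ∷ xs) {m} pm | no ¬px | _ with minimalBelow xs pm
    ...   | m' , pm' , m'≤m , least = m' , pm' , m'≤m , least'
      where
        least' : ∀ {z} → z ∈ x ∷ xs → P z → ¬ z < m'
        least' (here refl) px = ⊥-elim (¬px px)
        least' (there z∈)  pz = least z∈ pz

T-injective : ∀ {x y} → (T x → T y) → (T y → T x) → x ≡ y
T-injective {false} {false} _ _ = refl
T-injective {false} {true}  _ f = ⊥-elim (f _)
T-injective {true}  {false} t _ = ⊥-elim (t _)
T-injective {true}  {true}  _ _ = refl

module _ {n : ℕ} where

  Before : (Fin n → ℕ∞) → Fin n → Fin n → Set
  Before D w v = T (precedes (D w) w (D v) v)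

  rank : (Fin n → ℕ∞) → Fin n → ℕ
  rank D v = count (λ w → T? (precedes (D w) w (D v) v)) (allFin n)

  isNearest : ℕ → (Fin n → ℕ∞) → Fin n → Bool
  isNearest k D v = rank D v <ᵇ k

  isNearest⇒InNearest : ∀ {k} D v → T (isNearest k D v) → InNearest k D v
  isNearest⇒InNearest D v = <ᵇ⇒< _ _

  InNearest⇒isNearest : ∀ {k} D v → InNearest k D v → T (isNearest k D v)
  InNearest⇒isNearest D v = <⇒<ᵇ

  module _ (D : Fin n → ℕ∞) where

    Before⇒≺ : ∀ {w v} → Before D w v → (D w , toℕ w) ≺ (D v , toℕ v)
    Before⇒≺ = precedes⇒≺ _ _ _ _

    ≺⇒Before : ∀ {w v} → (D w , toℕ w) ≺ (D v , toℕ v) → Before D w v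
    ≺⇒Before {w} {v} = ≺⇒precedes {a = D w} {b = D v}

    Before-trans : ∀ {x y z} → Before D x y → Before D y z → Before D x z
    Before-trans p q = ≺⇒Before (≺-trans (Before⇒≺ p) (Before⇒≺ q))

    Before-irrefl : ∀ {x} → ¬ Before D x x
    Before-irrefl = ≺-irrefl ∘ Before⇒≺

    Before-total : ∀ {x y} → x ≢ y → Before D x y ⊎ Before D y x
    Before-total x≢y with ≺-total (x≢y ∘ toℕ-injective)
    ... | inj₁ lt = inj₁ (≺⇒Before lt)
    ... | inj₂ gt = inj₂ (≺⇒Before gt)

    Before? : ∀ x y → Dec (Before D x y)
    Before? x y = T? _

  rank-anti : ∀ {D E : Fin n → ℕ∞} {v} → (∀ x → D x ≤∞ E x) → D v ≡ E v → rank E v ≤ rank D v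
  rank-anti {D} {E} {v} D≤E Dv≡Ev = count-mono _ _ (allFin n) beforeD
    where
      beforeD : ∀ {x} → x ∈ allFin n → Before E x v → Before D x v
      beforeD {x} _ p = ≺⇒Before D (≺-respˡ-≤∞ (D≤E x) (subst (λ z → (E x , toℕ x) ≺ (z , toℕ v)) (sym Dv≡Ev) (Before⇒≺ E p)))

  rank-< : ∀ {D E : Fin n → ℕ∞} {w v} → (∀ x → D x ≤∞ E x) → E w <∞ D v → rank E w ≤ rank D v
  rank-< {D} {E} {w} {v} D≤E Ew<Dv = count-mono _ _ (allFin n) beforeD
    where
      beforeD : ∀ {x} → x ∈ allFin n → Before E x w → Before D x v
      beforeD {x} _ p = ≺⇒Before D (inj₁ (≤-<∞-trans (≤∞-trans (D≤E x) (≺⇒≤∞ (Before⇒≺ E p))) Ew<Dv))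

  module _ (k : ℕ) where

    nearest-stable : ∀ (D E : Fin n → ℕ∞) → (∀ v → InNearest k D v → E v ≡ D v) → (∀ v → D v ≤∞ E v) →
                     ∀ v → isNearest k E v ≡ isNearest k D v
    nearest-stable D E E≡D D≤E v = T-injective (InNearest⇒isNearest D v ∘ fromE ∘ isNearest⇒InNearest E v)
                                                  (InNearest⇒isNearest E v ∘ toE ∘ isNearest⇒InNearest D v)
      where
        toE : InNearest k D v → InNearest k E v
        toE nearD = ≤-<-trans (rank-anti D≤E (sym (E≡D v nearD))) nearD

        -- The D-first node m outside N_k(D) has k nodes before it, all in N_k(D), so they precede v under E as well.
        fromE : InNearest k E v → InNearest k D v
        fromE nearE with rank D v <? k
        ... | yes nearD = nearD
        ... | no farD with minimalBelow (Before-trans D) (Before-irrefl D) (Before? D) (λ z → ¬? (rank D z <? k)) (allFin n) farD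
        ...   | m , farM , m≤v , least = ⊥-elim (farM (≤-<-trans (count-mono _ _ (allFin n) beforeE) nearE))
          where
            nearBelowM : ∀ {x} → Before D x m → InNearest k D x
            nearBelowM {x} p with rank D x <? k
            ... | yes near = near
            ... | no far   = ⊥-elim (least (∈-allFin x) far p)
            beforeE : ∀ {x} → x ∈ allFin n → Before D x m → Before E x v
            beforeE {x} _ p = ≺⇒Before E (subst (λ z → (z , toℕ x) ≺ (E v , toℕ v)) (sym (E≡D x (nearBelowM p)))
                                (≺-respʳ-≤∞ (D≤E v) (Before⇒≺ D (below m≤v))))
              where
                below : m ≡ v ⊎ Before D m v → Before D x v
                below (inj₁ refl) = p
                below (inj₂ q)    = Before-trans D p q

    nearest? : (D : Fin n → ℕ∞) → Decidable (T ∘ isNearest k D)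
    nearest? D v = T? (isNearest k D v)

    nearest-count-≤ : ∀ (D : Fin n → ℕ∞) → count (nearest? D) (allFin n) ≤ k
    nearest-count-≤ D with count (nearest? D) (allFin n) in e
    ... | zero  = z≤n
    ... | suc _ with count-pos (nearest? D) (allFin n) (subst (0 <_) (sym e) z<s)
    ...   | m₀ , _ , nearM₀ with minimalBelow (flip (Before-trans D)) (Before-irrefl D) (flip (Before? D)) (nearest? D) (allFin n) nearM₀
    ...     | m , nearM , _ , greatest = subst (_≤ k) e (begin
      count (nearest? D) (allFin n)     ≤⟨ count-≤-suc (nearest? D) (flip (Before? D) m) m (allFin n) (allFin⁺ n) atMostM ⟩
      suc (rank D m)                    ≤⟨ isNearest⇒InNearest D m nearM ⟩
      k                                 ∎)
      where
        open ≤-Reasoning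
        atMostM : ∀ {x} → x ∈ allFin n → T (isNearest k D x) → x ≡ m ⊎ Before D x m
        atMostM {x} _ nearX with x ≟ᶠ m
        ... | yes x≡m = inj₁ x≡m
        ... | no x≢m with Before-total D x≢m
        ...   | inj₁ p = inj₂ p
        ...   | inj₂ q = ⊥-elim (greatest (∈-allFin x) nearX q)

Triple : ℕ → Set
Triple n = Fin n × Fin n × ℕ∞

viaTriple : ∀ {n} → (Fin n → ℕ∞) → Fin n → Triple n → ℕ∞
viaTriple D y (w , y' , δ) with y' ≟ᶠ y
... | yes _ = D w +∞ δ
... | no  _ = nothing

viaTriple-self : ∀ {n} (D : Fin n → ℕ∞) w y δ → viaTriple D y (w , y , δ) ≡ D w +∞ δ
viaTriple-self D w y δ with y ≟ᶠ y
... | yes _   = refl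
... | no y≢y = ⊥-elim (y≢y refl)

minPlus : ∀ {n} → (Fin n → ℕ∞) → List (Triple n) → Fin n → ℕ∞
minPlus D ts y = minOver ts (viaTriple D y)

module Nearest {n} (W : Graph n) {d} (pw : PolyWeights d W) (k : ℕ) where

  record KnowsNearest (r : ℕ) (u : Fin n) (S : Fin n → Bool) (D : Fin n → ℕ∞) : Set where
    field
      set≡  : ∀ v → S v ≡ isNearest k (hopDist W r u) v
      dist≡ : ∀ v → InNearest k (hopDist W r u) v → D v ≡ hopDist W r u v

    member⇒InNearest : ∀ {v} → T (S v) → InNearest k (hopDist W r u) v
    member⇒InNearest {v} t = isNearest⇒InNearest (hopDist W r u) v (subst T (set≡ v) t)

    InNearest⇒member : ∀ {v} → InNearest k (hopDist W r u) v → T (S v)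
    InNearest⇒member {v} near = subst T (sym (set≡ v)) (InNearest⇒isNearest (hopDist W r u) v near)

    correct : CorrectNearest W r k u (S , D)
    correct = hopDist W r u , hopDist-correct W r u ,
              (λ v → member⇒InNearest ∘ Equivalence.from T-≡ , Equivalence.to T-≡ ∘ InNearest⇒member) ,
              dist≡

  open KnowsNearest public

  knowsNearest-hopDist : ∀ r u → KnowsNearest r u (isNearest k (hopDist W r u)) (hopDist W r u)
  knowsNearest-hopDist r u = record { set≡ = λ _ → refl ; dist≡ = λ _ _ → refl }

  nearest-suffix : ∀ a b u w v {α} → hopDist W a u w ≡ just α → hopDist W (a + b) u v ≡ just α +∞ hopDist W b w v →
                   InNearest k (hopDist W (a + b) u) v → InNearest k (hopDist W b w) v
  nearest-suffix a b u w v {α} eα eᵥ near = ≤-<-trans (count-mono _ _ (allFin n) before) near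
    where
      before : ∀ {y} → y ∈ allFin n → Before (hopDist W b w) y v → Before (hopDist W (a + b) u) y v
      before {y} _ p = ≺⇒Before (hopDist W (a + b) u)
        (≺-respˡ-≤∞ (subst (λ z → hopDist W (a + b) u y ≤∞ z +∞ hopDist W b w y) eα (hopDist-triangle W a b u w y))
          (subst (λ z → (_ , toℕ y) ≺ (z , toℕ v)) (sym eᵥ) (≺-+∞-shift α (Before⇒≺ (hopDist W b w) p))))

  hopDist-at-split : ∀ a b {u w v h l₁ l₂ m} → hopDist W (a + b) u v ≡ just m → Walk W u w a l₁ → Walk W w v h l₂ →
                     h ≤ b → l₁ + l₂ ≡ m → hopDist W a u w +∞ hopDist W b w v ≡ just m
  hopDist-at-split a b {u} {w} {v} e p₁ p₂ h≤b l₁+l₂≡m =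
    ≤∞-antisym (subst (λ z → _ ≤∞ just z) l₁+l₂≡m (+∞-mono-≤∞ (hopDist-≤-walk W ≤-refl p₁) (hopDist-≤-walk W h≤b p₂)))
               (subst (_≤∞ hopDist W a u w +∞ hopDist W b w v) e (hopDist-triangle W a b u w v))

  nearest-split-short : ∀ a b u v {h l} → hopDist W (a + b) u v ≡ just l → Walk W u v h l → h ≤ a →
    InNearest k (hopDist W (a + b) u) v →
    hopDist W a u v +∞ hopDist W b v v ≡ just l × InNearest k (hopDist W a u) v × InNearest k (hopDist W b v) v
  nearest-split-short a b u v {l = l} e p h≤a near =
    via , ≤-<-trans (rank-anti (hopDist-mono W a b u) (trans e (sym Dav≡l))) near ,
    nearest-suffix a b u v v Dav≡l (trans e (sym (trans (cong (just l +∞_) (hopDist-refl W b v)) (+∞-identityʳ _)))) near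
    where
      Dav≡l : hopDist W a u v ≡ just l
      Dav≡l = ≤∞-antisym (hopDist-≤-walk W h≤a p) (subst (_≤∞ hopDist W a u v) e (hopDist-mono W a b u v))
      via : hopDist W a u v +∞ hopDist W b v v ≡ just l
      via = trans (cong (hopDist W a u v +∞_) (hopDist-refl W b v)) (trans (+∞-identityʳ _) Dav≡l)

  nearest-split-long : ∀ a b u w v {h l₁ l₂ m} → hopDist W (a + b) u v ≡ just m → Walk W u w a l₁ → Walk W w v h l₂ →
    h ≤ b → 0 < h → l₁ + l₂ ≡ m → InNearest k (hopDist W (a + b) u) v →
    hopDist W a u w +∞ hopDist W b w v ≡ just m × InNearest k (hopDist W a u) w × InNearest k (hopDist W b w) v
  nearest-split-long a b u w v {l₁ = l₁} {l₂} {m} e p₁ p₂ h≤b h>0 l₁+l₂≡m near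
    with +∞≡justˡ (hopDist-at-split a b e p₁ p₂ h≤b l₁+l₂≡m)
  ... | α , eα = via , ≤-<-trans (rank-< (hopDist-mono W a b u) (subst₂ _<∞_ (sym eα) (sym e) [ α<m ])) near ,
                 nearest-suffix a b u w v eα (trans e (sym (subst (λ z → z +∞ _ ≡ just m) eα via))) near
    where
      via : hopDist W a u w +∞ hopDist W b w v ≡ just m
      via = hopDist-at-split a b e p₁ p₂ h≤b l₁+l₂≡m
      α<m : α < m
      α<m = begin-strict
        α        ≤⟨ [≤]-injective (subst (_≤∞ _) eα (hopDist-≤-walk W ≤-refl p₁)) ⟩
        l₁       <⟨ m<m+n l₁ (walk-length-pos W {d} pw p₂ h>0) ⟩
        l₁ + l₂  ≡⟨ l₁+l₂≡m ⟩
        m        ∎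
        where
          open ≤-Reasoning

  nearest-split : ∀ a b u v {m} → hopDist W (a + b) u v ≡ just m → InNearest k (hopDist W (a + b) u) v →
    ∃ λ w → hopDist W a u w +∞ hopDist W b w v ≡ just m × InNearest k (hopDist W a u) w × InNearest k (hopDist W b w) v
  nearest-split a b u v e near with hopDist-sound W (a + b) u v e
  ... | h , h≤a+b , p with h ≤? a
  ...   | yes h≤a = v , nearest-split-short a b u v e p h≤a near
  ...   | no h≰a with splitWalk W p a (≰⇒> h≰a)
  ...     | w , l₁ , l₂ , p₁ , p₂ , l₁+l₂≡m =
    w , nearest-split-long a b u w v e p₁ p₂ (subst (h ∸ a ≤_) (m+n∸m≡n a b) (∸-monoˡ-≤ a h≤a+b))
                           (m<n⇒0<n∸m (≰⇒> h≰a)) l₁+l₂≡m near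

  knowsNearest-minPlus : ∀ a b u {Su Du} {Sw : Fin n → Fin n → Bool} {Dw : Fin n → Fin n → ℕ∞} (ts : List (Triple n)) →
    KnowsNearest a u Su Du → (∀ w → KnowsNearest b w (Sw w) (Dw w)) →
    (∀ {w y δ} → (w , y , δ) ∈ ts → T (Su w) × T (Sw w y) × δ ≡ Dw w y) →
    (∀ {w y} → T (Su w) → T (Sw w y) → (w , y , Dw w y) ∈ ts) →
    KnowsNearest (a + b) u (isNearest k (minPlus Du ts)) (minPlus Du ts)
  knowsNearest-minPlus a b u {Su} {Du} {Sw} {Dw} ts knowsU knowsW sound complete = record
    { set≡  = nearest-stable k Dist E E≡Dist Dist≤E
    ; dist≡ = E≡Dist
    }
    where
      Dist : Fin n → ℕ∞
      Dist = hopDist W (a + b) u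
      E : Fin n → ℕ∞
      E = minPlus Du ts

      Dist≤E : ∀ y → Dist y ≤∞ E y
      Dist≤E y = ≤-minOver ts (viaTriple Du y) Dist≤via
        where
          Dist≤via : ∀ t → t ∈ ts → Dist y ≤∞ viaTriple Du y t
          Dist≤via (w , y' , δ) t∈ with y' ≟ᶠ y
          ... | no _ = _ ≤⊤⁺
          ... | yes refl with sound t∈
          ...   | w∈ , y∈ , refl =
            subst₂ (λ p q → Dist y ≤∞ p +∞ q) (sym (dist≡ knowsU w (member⇒InNearest knowsU w∈)))
                   (sym (dist≡ (knowsW w) y (member⇒InNearest (knowsW w) y∈))) (hopDist-triangle W a b u w y)

      E≡Dist : ∀ v → InNearest k Dist v → E v ≡ Dist v
      E≡Dist v near = attained (Dist v) refl
        where
          attained : ∀ x → Dist v ≡ x → E v ≡ x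
          attained nothing  e = ≤∞-antisym (_ ≤⊤⁺) (subst (_≤∞ E v) e (Dist≤E v))
          attained (just m) e with nearest-split a b u v e near
          ... | w , via , nearW , nearV = ≤∞-antisym E≤m (subst (_≤∞ E v) e (Dist≤E v))
            where
              E≤m : E v ≤∞ just m
              E≤m = ≤∞-trans (minOver-≤ ts (viaTriple Du v)
                                (complete (InNearest⇒member knowsU nearW) (InNearest⇒member (knowsW w) nearV)))
                      (≤∞-reflexive (trans (viaTriple-self Du w v (Dw w v))
                                    (trans (cong₂ _+∞_ (dist≡ knowsU w nearW) (dist≡ (knowsW w) v nearV)) via)))

n≤2^⌈log₂n⌉ : ∀ n → n ≤ 2 ^ ⌈log₂ n ⌉
n≤2^⌈log₂n⌉ n = <-rec (λ n → n ≤ 2 ^ ⌈log₂ n ⌉) byHalving n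
  where
    n≤⌈n/2⌉+⌈n/2⌉ : ∀ n → n ≤ ⌈ n /2⌉ + ⌈ n /2⌉
    n≤⌈n/2⌉+⌈n/2⌉ zero          = z≤n
    n≤⌈n/2⌉+⌈n/2⌉ (suc zero)    = s≤s z≤n
    n≤⌈n/2⌉+⌈n/2⌉ (suc (suc m)) = s≤s (subst (suc m ≤_) (sym (+-suc ⌈ m /2⌉ ⌈ m /2⌉)) (s≤s (n≤⌈n/2⌉+⌈n/2⌉ m)))

    byHalving : ∀ n → (∀ {m} → m < n → m ≤ 2 ^ ⌈log₂ m ⌉) → n ≤ 2 ^ ⌈log₂ n ⌉
    byHalving zero          _  = z≤n
    byHalving (suc zero)    _  = s≤s z≤n
    byHalving n@(suc (suc m)) ih = begin
      n                                ≤⟨ n≤⌈n/2⌉+⌈n/2⌉ n ⟩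
      ⌈ n /2⌉ + ⌈ n /2⌉                ≤⟨ +-mono-≤ half≤ half≤ ⟩
      2 ^ (L ∸ 1) + 2 ^ (L ∸ 1)        ≡⟨ cong (2 ^ (L ∸ 1) +_) (sym (+-identityʳ _)) ⟩
      2 * 2 ^ (L ∸ 1)                  ≡⟨ cong (2 ^_) (m+[n∸m]≡n {1} {L} (⌈log₂⌉-mono-≤ {2} {n} (s≤s (s≤s z≤n)))) ⟩
      2 ^ L                            ∎
      where
        open ≤-Reasoning
        L : ℕ
        L = ⌈log₂ n ⌉
        half≤ : ⌈ n /2⌉ ≤ 2 ^ (L ∸ 1)
        half≤ = subst (λ z → ⌈ n /2⌉ ≤ 2 ^ z) (⌈log₂⌈n/2⌉⌉≡⌈log₂n⌉∸1 n) (ih (s≤s (s≤s (⌈n/2⌉≤n m))))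

-- Message encoding

bitValue : Bool → ℕ
bitValue true  = 1
bitValue false = 0

toBits : ℕ → ℕ → Msg
toBits zero    x = []
toBits (suc w) x = (x % 2 ≡ᵇ 1) ∷ toBits w (x / 2)

fromBits : Msg → ℕ
fromBits []       = 0
fromBits (b ∷ bs) = bitValue b + 2 * fromBits bs

length-toBits : ∀ w x → length (toBits w x) ≡ w
length-toBits zero    x = refl
length-toBits (suc w) x = cong suc (length-toBits w (x / 2))

fromBits-toBits : ∀ w x → x < 2 ^ w → fromBits (toBits w x) ≡ x
fromBits-toBits zero    zero    _ = refl
fromBits-toBits zero    (suc x) (s≤s ())
fromBits-toBits (suc w) x x<2^w+1 = begin
  bitValue (x % 2 ≡ᵇ 1) + 2 * fromBits (toBits w (x / 2)) ≡⟨ cong₂ _+_ (lowBit (x % 2) (m%n<n x 2))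
                                                                      (cong (2 *_) (fromBits-toBits w (x / 2) x/2<2^w)) ⟩
  x % 2 + 2 * (x / 2)                                     ≡⟨ cong (x % 2 +_) (*-comm 2 (x / 2)) ⟩
  x % 2 + x / 2 * 2                                       ≡⟨ m≡m%n+[m/n]*n x 2 ⟨
  x                                                       ∎
  where
    open ≡-Reasoning
    lowBit : ∀ r → r < 2 → bitValue (r ≡ᵇ 1) ≡ r
    lowBit zero       _ = refl
    lowBit (suc zero) _ = refl
    lowBit (suc (suc r)) (s≤s (s≤s ()))
    x/2<2^w : x / 2 < 2 ^ w
    x/2<2^w = m<n*o⇒m/o<n (subst (x <_) (*-comm 2 (2 ^ w)) x<2^w+1)

encodeFields : ℕ → ℕ → (ℕ → ℕ) → Msg
encodeFields w zero    f = []
encodeFields w (suc F) f = toBits w (f 0) ++ encodeFields w F (f ∘ suc)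

length-encodeFields : ∀ w F f → length (encodeFields w F f) ≡ F * w
length-encodeFields w zero    f = refl
length-encodeFields w (suc F) f =
  trans (length-++ (toBits w (f 0))) (cong₂ _+_ (length-toBits w (f 0)) (length-encodeFields w F (f ∘ suc)))

fieldAt : ℕ → ℕ → Msg → ℕ
fieldAt w j bs = fromBits (take w (drop (j * w) bs))

take-length-++ : {A : Set} (xs ys : List A) → take (length xs) (xs ++ ys) ≡ xs
take-length-++ []       ys = refl
take-length-++ (x ∷ xs) ys = cong (x ∷_) (take-length-++ xs ys)

drop-length-++ : {A : Set} (xs ys : List A) (m : ℕ) → drop (length xs + m) (xs ++ ys) ≡ drop m ys
drop-length-++ []       ys m = refl
drop-length-++ (x ∷ xs) ys m = drop-length-++ xs ys m

fieldAt-encodeFields : ∀ w F f j → j < F → (∀ i → i < F → f i < 2 ^ w) → fieldAt w j (encodeFields w F f) ≡ f j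
fieldAt-encodeFields w (suc F) f zero _ bound = begin
  fromBits (take w (toBits w (f 0) ++ rest))  ≡⟨ cong (λ z → fromBits (take z (toBits w (f 0) ++ rest))) (length-toBits w (f 0)) ⟨
  fromBits (take (length (toBits w (f 0))) (toBits w (f 0) ++ rest))
                                              ≡⟨ cong fromBits (take-length-++ (toBits w (f 0)) rest) ⟩
  fromBits (toBits w (f 0))                   ≡⟨ fromBits-toBits w (f 0) (bound 0 z<s) ⟩
  f 0                                         ∎
  where
    open ≡-Reasoning
    rest : Msg
    rest = encodeFields w F (f ∘ suc)
fieldAt-encodeFields w (suc F) f (suc j) (s≤s j<F) bound = begin
  fromBits (take w (drop (w + j * w) (toBits w (f 0) ++ rest)))
    ≡⟨ cong (λ z → fromBits (take w (drop (z + j * w) (toBits w (f 0) ++ rest)))) (length-toBits w (f 0)) ⟨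
  fromBits (take w (drop (length (toBits w (f 0)) + j * w) (toBits w (f 0) ++ rest)))
    ≡⟨ cong (fromBits ∘ take w) (drop-length-++ (toBits w (f 0)) rest (j * w)) ⟩
  fieldAt w j rest
    ≡⟨ fieldAt-encodeFields w F (f ∘ suc) j j<F (λ i i<F → bound (suc i) (s≤s i<F)) ⟩
  f (suc j) ∎
  where
    open ≡-Reasoning
    rest : Msg
    rest = encodeFields w F (f ∘ suc)

fromBits-< : ∀ bs → fromBits bs < 2 ^ length bs
fromBits-< []       = z<s
fromBits-< (b ∷ bs) = begin-strict
  bitValue b + 2 * fromBits bs      ≤⟨ +-monoˡ-≤ _ (bit≤1 b) ⟩
  1 + 2 * fromBits bs               <⟨ n<1+n _ ⟩
  2 + 2 * fromBits bs               ≡⟨ *-suc 2 (fromBits bs) ⟨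
  2 * suc (fromBits bs)             ≤⟨ *-monoʳ-≤ 2 (fromBits-< bs) ⟩
  2 * 2 ^ length bs                 ∎
  where
    open ≤-Reasoning
    bit≤1 : ∀ b → bitValue b ≤ 1
    bit≤1 true  = ≤-refl
    bit≤1 false = z≤n

fieldAt-< : ∀ w j bs → fieldAt w j bs < 2 ^ w
fieldAt-< w j bs = <-≤-trans (fromBits-< (take w (drop (j * w) bs)))
                     (^-monoʳ-≤ 2 (subst (_≤ w) (sym (length-take w _)) (m⊓n≤m w _)))

pack : ℕ → ℕ → ℕ → ℕ
pack B i j = i + j * B

module _ (B : ℕ) {{_ : NonZero B}} where

  pack-% : ∀ {i} j → i < B → pack B i j % B ≡ i
  pack-% {i} j i<B = trans ([m+kn]%n≡m%n i j B) (m<n⇒m%n≡m i<B)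

  pack-/ : ∀ {i} j → i < B → pack B i j / B ≡ j
  pack-/ {i} j i<B = begin
    (i + j * B) / B           ≡⟨ +-distrib-/ i (j * B) noCarry ⟩
    i / B + j * B / B         ≡⟨ cong₂ _+_ (m<n⇒m/n≡0 i<B) (m*n/n≡m j B) ⟩
    j                         ∎
    where
      open ≡-Reasoning
      noCarry : i % B + j * B % B < B
      noCarry = subst (_< B) (sym (trans (cong₂ _+_ (m<n⇒m%n≡m i<B) (m*n%n≡0 j B)) (+-identityʳ i))) i<B

  pack-< : ∀ {i j m} → i < B → j < m → pack B i j < m * B
  pack-< {i} {j} i<B j<m = <-≤-trans (+-monoˡ-< (j * B) i<B) (*-monoˡ-≤ B j<m)

  pack-unpack : ∀ x → pack B (x % B) (x / B) ≡ x
  pack-unpack x = sym (m≡m%n+[m/n]*n x B)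

entryAt : {A : Set} → List A → ℕ → Maybe A
entryAt []       _       = nothing
entryAt (x ∷ xs) zero    = just x
entryAt (x ∷ xs) (suc i) = entryAt xs i

members : ∀ {n} → (Fin n → Bool) → List (Fin n)
members {n} S = filter (λ v → T? (S v)) (allFin n)

-- Code 0 stands for "no node" and for distance ∞.
encodeNode : ∀ {n} → Maybe (Fin n) → ℕ
encodeNode nothing  = 0
encodeNode (just y) = suc (toℕ y)

decodeNode : ∀ {n} → ℕ → Maybe (Fin n)
decodeNode         zero    = nothing
decodeNode {n} (suc m) with m <? n
... | yes m<n = just (fromℕ< m<n)
... | no  _   = nothing

encodeDist : ℕ∞ → ℕ
encodeDist nothing  = 0
encodeDist (just m) = suc m

decodeDist : ℕ → ℕ∞
decodeDist zero    = nothing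
decodeDist (suc m) = just m

entryAt-∈ : {A : Set} (xs : List A) (i : ℕ) {x : A} → entryAt xs i ≡ just x → x ∈ xs
entryAt-∈ (y ∷ xs) zero    refl = here refl
entryAt-∈ (y ∷ xs) (suc i) e    = there (entryAt-∈ xs i e)

∈-entryAt : {A : Set} {xs : List A} {x : A} → x ∈ xs → ∃ λ i → i < length xs × entryAt xs i ≡ just x
∈-entryAt (here refl) = 0 , z<s , refl
∈-entryAt (there x∈)  with ∈-entryAt x∈
... | i , i<len , e = suc i , s≤s i<len , e

∈-members⁻ : ∀ {n} (S : Fin n → Bool) {x} → x ∈ members S → T (S x)
∈-members⁻ {n} S = proj₂ ∘ ∈-filter⁻ (λ v → T? (S v)) {xs = allFin n}

∈-members⁺ : ∀ {n} (S : Fin n → Bool) {x} → T (S x) → x ∈ members S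
∈-members⁺ S {x} = ∈-filter⁺ (λ v → T? (S v)) (∈-allFin x)

decodeNode-encodeNode : ∀ {n} (o : Maybe (Fin n)) → decodeNode (encodeNode o) ≡ o
decodeNode-encodeNode nothing = refl
decodeNode-encodeNode {n} (just y) with toℕ y <? n
... | yes y<n = cong just (fromℕ<-toℕ y y<n)
... | no  y≮n = ⊥-elim (y≮n (toℕ<n y))

decodeDist-encodeDist : ∀ x → decodeDist (encodeDist x) ≡ x
decodeDist-encodeDist nothing  = refl
decodeDist-encodeDist (just m) = refl

-- The protocol

record State (n : ℕ) : Set where
  field
    curSet  baseSet  : Fin n → Bool
    curDist baseDist : Fin n → ℕ∞
    phase            : ℕ
open State public

knowing : ∀ {n} → ℕ → (Fin n → ℕ∞) → (Fin n → ℕ∞) → ℕ → State n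
knowing k cur base p = record
  { curSet = isNearest k cur ; curDist = cur ; baseSet = isNearest k base ; baseDist = base ; phase = p }

wraps : ℕ → ℕ → Bool
wraps h c = suc c ≡ᵇ h ∸ 1

isEven : {A : Set} → List A → Bool
isEven []          = true
isEven (_ ∷ [])    = false
isEven (_ ∷ _ ∷ l) = isEven l

lastRound : ∀ {n} → History n → Fin n → Msg
lastRound []      _ = []
lastRound (r ∷ _)   = r

candidate : ∀ {n} → Maybe (Fin n) → Maybe (Fin n) → ℕ∞ → List (Triple n)
candidate (just w) (just y) δ = (w , y , δ) ∷ []
candidate _        _        _ = []

-- A phase takes two rounds. Lists are cut into blocks of B entries, and node x = τ + γ g relays
-- block τ of every cur-list against block γ of every base-list.
-- Round 1: each node w sends relay x its base block γ (ids and distances) and its cur block τ (requests).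
-- Round 2: relay x sends each u, for every request w of u, the base block γ of w.
module Exchange (n h k B g Wd : ℕ) {{_ : NonZero B}} {{_ : NonZero g}} where

  curEntry baseEntry : State n → ℕ → Maybe (Fin n)
  curEntry  s = entryAt (members (curSet s))
  baseEntry s = entryAt (members (baseSet s))

  row column : Fin n → ℕ
  row    x = toℕ x % g
  column x = toℕ x / g

  -- kind 0: base ids, kind 1: base distances, kind 2: requests
  round1Value : State n → Fin n → ℕ → ℕ → ℕ
  round1Value s x zero          slot = encodeNode (baseEntry s (pack B slot (column x)))
  round1Value s x (suc zero)    slot = encodeDist (maybe′ (baseDist s) nothing (baseEntry s (pack B slot (column x))))
  round1Value s x (suc (suc _)) slot = encodeNode (curEntry s (pack B slot (row x)))

  round1Msg : State n → Fin n → Msg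
  round1Msg s x = encodeFields Wd (3 * B) (λ j → round1Value s x (j / B) (j % B))

  forward : (Fin n → Msg) → Fin n → ℕ → ℕ → ℕ → ℕ
  forward r1 u ι κ kind = maybe′ (λ w → fieldAt Wd (pack B κ kind) (r1 w)) 0 (decodeNode (fieldAt Wd (pack B ι 2) (r1 u)))

  round2Msg : (Fin n → Msg) → Fin n → Msg
  round2Msg r1 u = encodeFields Wd ((2 * B) * B) (λ j → forward r1 u ((j / B) % B) (j % B) (j / B / B))

  tripleFrom : State n → Msg → Fin n → ℕ → ℕ → List (Triple n)
  tripleFrom s r2 x ι κ = candidate (curEntry s (pack B ι (row x)))
                                    (decodeNode (fieldAt Wd (pack B κ (pack B ι 0)) r2))
                                    (decodeDist (fieldAt Wd (pack B κ (pack B ι 1)) r2))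

  receivedTriples : State n → (Fin n → Msg) → List (Triple n)
  receivedTriples s r2 = concatMap (λ x → concatMap (λ ι → concatMap (tripleFrom s (r2 x) x ι) (upTo B)) (upTo B)) (allFin n)

  -- Every h - 1 phases the cur radius reaches h times the base radius and becomes the new base.
  update : State n → (Fin n → Msg) → State n
  update s r2 = if wraps h (phase s) then knowing k E E 0 else newCur
    where
      E : Fin n → ℕ∞
      E = minPlus (curDist s) (receivedTriples s r2)
      newCur : State n
      newCur = record s { curSet = isNearest k E ; curDist = E ; phase = suc (phase s) }

  -- Computed from u's own out-edges, D₁ is hopDist W 1 u by definition.
  initial : Fin n → Input n → State n
  initial u (out , _) = knowing k D₁ D₁ 0
    where
      D₁ : Fin n → ℕ∞
      D₁ = relax out dist₀ u

  stateOf : Fin n → Input n → History n → State n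
  stateOf u inp []                = initial u inp
  stateOf u inp (_ ∷ [])          = initial u inp
  stateOf u inp (r2 ∷ _ ∷ rounds) = update (stateOf u inp rounds) r2

  protocol : Protocol n
  protocol = record
    { send   = λ u inp rounds → if isEven rounds then round1Msg (stateOf u inp rounds) else round2Msg (lastRound rounds)
    ; output = λ u inp rounds → curSet (stateOf u inp rounds) , curDist (stateOf u inp rounds)
    }

-- Correctness of the protocol

maybe-cong : {A B : Set} {f g : A → B} {z : B} (o : Maybe A) → (∀ a → f a ≡ g a) → maybe′ f z o ≡ maybe′ g z o
maybe-cong nothing  _   = refl
maybe-cong (just a) f≗g = f≗g a

module PhaseCorrect (n h k B g Wd : ℕ) {{_ : NonZero B}} {{_ : NonZero g}}
                    (W : Graph n) {d : ℕ} (pw : PolyWeights d W) (wide : n ^ suc d < 2 ^ Wd) where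

  open Exchange n h k B g Wd
  open Nearest W {d} pw k

  record Informed (a b : ℕ) (u : Fin n) (s : State n) : Set where
    field
      cur  : KnowsNearest a u (curSet s) (curDist s)
      base : KnowsNearest b u (baseSet s) (baseDist s)
  open Informed public

  0<2^Wd : 0 < 2 ^ Wd
  0<2^Wd = m^n>0 2 Wd

  encodeNode-< : ∀ o → encodeNode {n} o < 2 ^ Wd
  encodeNode-< nothing  = 0<2^Wd
  encodeNode-< (just y) = ≤-<-trans (≤-trans (toℕ<n y) (m≤m*n n (n ^ d))) wide
    where instance
      _ : NonZero (n ^ d)
      _ = m^n≢0 n d {{>-nonZero (≤-<-trans z≤n (toℕ<n y))}}

  encodeDist-hopDist-< : ∀ r w y → encodeDist (hopDist W r w y) < 2 ^ Wd
  encodeDist-hopDist-< r w y with hopDist W r w y in e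
  ... | nothing = 0<2^Wd
  ... | just m  = ≤-<-trans (hopDist-< W {d} pw r w y e) wide

  forward-< : ∀ r1 u ι κ kind → forward r1 u ι κ kind < 2 ^ Wd
  forward-< r1 u ι κ kind with decodeNode {n} (fieldAt Wd (pack B ι 2) (r1 u))
  ... | nothing = 0<2^Wd
  ... | just w  = fieldAt-< Wd (pack B κ kind) (r1 w)

  members-length-≤ : ∀ {r u S D} → KnowsNearest r u S D → length (members S) ≤ k
  members-length-≤ {r} {u} {S} knows =
    ≤-trans (count-mono (λ v → T? (S v)) (λ v → T? (isNearest k (hopDist W r u) v)) (allFin n)
                        (λ _ t → subst T (set≡ knows _) t))
            (nearest-count-≤ k (hopDist W r u))

  module _ {b w} {s : State n} (knows : KnowsNearest b w (baseSet s) (baseDist s)) (x : Fin n) where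

    round1Value-< : ∀ kind slot → round1Value s x kind slot < 2 ^ Wd
    round1Value-< zero          slot = encodeNode-< _
    round1Value-< (suc (suc _)) slot = encodeNode-< _
    round1Value-< (suc zero)    slot with baseEntry s (pack B slot (column x)) in e
    ... | nothing = 0<2^Wd
    ... | just y  = subst (λ z → encodeDist z < 2 ^ Wd) (sym (dist≡ knows y (member⇒InNearest knows y∈)))
                          (encodeDist-hopDist-< b w y)
      where
        y∈ : T (baseSet s y)
        y∈ = ∈-members⁻ (baseSet s) (entryAt-∈ (members (baseSet s)) _ e)

    round1-field : ∀ {kind slot} → kind < 3 → slot < B →
                   fieldAt Wd (pack B slot kind) (round1Msg s x) ≡ round1Value s x kind slot
    round1-field {kind} {slot} kind<3 slot<B =
      trans (fieldAt-encodeFields Wd (3 * B) _ (pack B slot kind) (pack-< B slot<B kind<3)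
                                  (λ i _ → round1Value-< (i / B) (i % B)))
            (cong₂ (round1Value s x) (pack-/ B kind slot<B) (pack-% B kind slot<B))

  expectedFrom : (Fin n → State n) → Fin n → ℕ → Maybe (Fin n) → List (Triple n)
  expectedFrom sts x κ nothing  = []
  expectedFrom sts x κ (just w) = candidate (just w) y (maybe′ (baseDist (sts w)) nothing y)
    where
      y : Maybe (Fin n)
      y = baseEntry (sts w) (pack B κ (column x))

  module Relay {b} (sts : Fin n → State n) (knowsBase : ∀ w → KnowsNearest b w (baseSet (sts w)) (baseDist (sts w)))
               (r1 : Fin n → Fin n → Msg) (r1≡ : ∀ x w → r1 x w ≡ round1Msg (sts w) x) where

    received1 : ∀ x w {kind slot} → kind < 3 → slot < B →
                fieldAt Wd (pack B slot kind) (r1 x w) ≡ round1Value (sts w) x kind slot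
    received1 x w {kind} {slot} kind<3 slot<B =
      trans (cong (fieldAt Wd (pack B slot kind)) (r1≡ x w)) (round1-field (knowsBase w) x kind<3 slot<B)

    forward-correct : ∀ x u {ι κ kind} → ι < B → κ < B → kind < 3 →
      forward (r1 x) u ι κ kind ≡ maybe′ (λ w → round1Value (sts w) x kind κ) 0 (curEntry (sts u) (pack B ι (row x)))
    forward-correct x u {ι} {κ} {kind} ι<B κ<B kind<3 =
      trans (cong (maybe′ (λ w → fieldAt Wd (pack B κ kind) (r1 x w)) 0)
                  (trans (cong decodeNode (received1 x u (s≤s (s≤s (s≤s z≤n))) ι<B)) (decodeNode-encodeNode o)))
            (maybe-cong o (λ w → received1 x w kind<3 κ<B))
      where
        o : Maybe (Fin n)
        o = curEntry (sts u) (pack B ι (row x))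

    received2 : ∀ x u {ι κ kind} → ι < B → κ < B → kind < 2 →
      fieldAt Wd (pack B κ (pack B ι kind)) (round2Msg (r1 x) u) ≡ forward (r1 x) u ι κ kind
    received2 x u {ι} {κ} {kind} ι<B κ<B kind<2 =
      trans (fieldAt-encodeFields Wd ((2 * B) * B) _ _ (pack-< B κ<B (pack-< B ι<B kind<2))
                                  (λ i _ → forward-< (r1 x) u ((i / B) % B) (i % B) (i / B / B)))
            digits
      where
        j : ℕ
        j = pack B κ (pack B ι kind)
        digits : forward (r1 x) u ((j / B) % B) (j % B) (j / B / B) ≡ forward (r1 x) u ι κ kind
        digits rewrite pack-/ B (pack B ι kind) κ<B | pack-% B (pack B ι kind) κ<B | pack-% B kind ι<B | pack-/ B kind ι<B
          = refl

    tripleFrom-correct : ∀ x u {r2} → r2 ≡ round2Msg (r1 x) u → ∀ {ι κ} → ι < B → κ < B →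
      tripleFrom (sts u) r2 x ι κ ≡ expectedFrom sts x κ (curEntry (sts u) (pack B ι (row x)))
    tripleFrom-correct x u refl {ι} {κ} ι<B κ<B =
      trans (cong₂ (candidate o) (cong decodeNode (fieldKind 0 z<s)) (cong decodeDist (fieldKind 1 (s≤s z<s)))) (decoded o)
      where
        o : Maybe (Fin n)
        o = curEntry (sts u) (pack B ι (row x))
        fieldKind : ∀ kind → kind < 2 →
          fieldAt Wd (pack B κ (pack B ι kind)) (round2Msg (r1 x) u) ≡ maybe′ (λ w → round1Value (sts w) x kind κ) 0 o
        fieldKind kind kind<2 = trans (received2 x u ι<B κ<B kind<2) (forward-correct x u ι<B κ<B (m<n⇒m<1+n kind<2))
        decoded : ∀ o → candidate o (decodeNode (maybe′ (λ w → round1Value (sts w) x 0 κ) 0 o))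
                                    (decodeDist (maybe′ (λ w → round1Value (sts w) x 1 κ) 0 o))
                      ≡ expectedFrom sts x κ o
        decoded nothing  = refl
        decoded (just w) = cong₂ (candidate (just w)) (decodeNode-encodeNode _) (decodeDist-encodeDist _)

  module Phase {a b} (sts : Fin n → State n) (informed : ∀ w → Informed a b w (sts w))
               (r1 : Fin n → Fin n → Msg) (r1≡ : ∀ x w → r1 x w ≡ round1Msg (sts w) x)
               (u : Fin n) (r2 : Fin n → Msg) (r2≡ : ∀ x → r2 x ≡ round2Msg (r1 x) u) where

    open Relay sts (base ∘ informed) r1 r1≡

    perRequest : Fin n → ℕ → List (Triple n)
    perRequest x ι = concatMap (tripleFrom (sts u) (r2 x) x ι) (upTo B)

    perRelay : Fin n → List (Triple n)
    perRelay x = concatMap (perRequest x) (upTo B)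

    expected-sound : ∀ x κ o {w y δ} → (w , y , δ) ∈ expectedFrom sts x κ o → o ≡ just w →
                     T (baseSet (sts w) y) × δ ≡ baseDist (sts w) y
    expected-sound x κ (just w) t∈ refl with baseEntry (sts w) (pack B κ (column x)) in e
    expected-sound x κ (just w) (here refl) refl | just y =
      ∈-members⁻ (baseSet (sts w)) (entryAt-∈ (members (baseSet (sts w))) _ e) , refl

    expected-owner : ∀ x κ o {t} → t ∈ expectedFrom sts x κ o → o ≡ just (proj₁ t)
    expected-owner x κ (just w) t∈ with baseEntry (sts w) (pack B κ (column x))
    expected-owner x κ (just w) (here refl) | just y = refl

    received-sound : ∀ {w y δ} → (w , y , δ) ∈ receivedTriples (sts u) r2 →
                     T (curSet (sts u) w) × T (baseSet (sts w) y) × δ ≡ baseDist (sts w) y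
    received-sound {w} {y} {δ} t∈ with find (∈-concatMap⁻ perRelay {xs = allFin n} t∈)
    ... | x , _ , t∈x with find (∈-concatMap⁻ (perRequest x) {xs = upTo B} t∈x)
    ... | ι , ι∈ , t∈ι with find (∈-concatMap⁻ (tripleFrom (sts u) (r2 x) x ι) {xs = upTo B} t∈ι)
    ... | κ , κ∈ , t∈κ = ∈-members⁻ (curSet (sts u)) (entryAt-∈ (members (curSet (sts u))) _ owner) ,
                         expected-sound x κ o t∈e owner
      where
        o : Maybe (Fin n)
        o = curEntry (sts u) (pack B ι (row x))
        t∈e : (w , y , δ) ∈ expectedFrom sts x κ o
        t∈e = subst (_ ∈_) (tripleFrom-correct x u (r2≡ x) (∈-upTo⁻ ι∈) (∈-upTo⁻ κ∈)) t∈κ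
        owner : o ≡ just w
        owner = expected-owner x κ o t∈e

    module _ (grid : g * g ≤ n) (blocks : k ≤ g * B) where

      received-complete : ∀ {w y} → T (curSet (sts u) w) → T (baseSet (sts w) y) →
                          (w , y , baseDist (sts w) y) ∈ receivedTriples (sts u) r2
      received-complete {w} {y} w∈ y∈
        with ∈-entryAt (∈-members⁺ (curSet (sts u)) w∈) | ∈-entryAt (∈-members⁺ (baseSet (sts w)) y∈)
      ... | p , p<len , ep | q , q<len , eq =
        ∈-concatMap⁺ perRelay (lose (∈-allFin x) (∈-concatMap⁺ (perRequest x) (lose (∈-upTo⁺ (m%n<n p B))
          (∈-concatMap⁺ (tripleFrom (sts u) (r2 x) x (p % B)) (lose (∈-upTo⁺ (m%n<n q B)) t∈)))))
        where
          blockOf : ∀ {i} → i < k → i / B < g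
          blockOf i<k = m<n*o⇒m/o<n (<-≤-trans i<k blocks)
          τ<g : p / B < g
          τ<g = blockOf (<-≤-trans p<len (members-length-≤ (cur (informed u))))
          γ<g : q / B < g
          γ<g = blockOf (<-≤-trans q<len (members-length-≤ (base (informed w))))
          x<n : pack g (p / B) (q / B) < n
          x<n = <-≤-trans (pack-< g τ<g γ<g) grid
          x : Fin n
          x = fromℕ< x<n
          p≡ : pack B (p % B) (row x) ≡ p
          p≡ = trans (cong (λ z → pack B (p % B) (z % g)) (toℕ-fromℕ< x<n))
                     (trans (cong (pack B (p % B)) (pack-% g (q / B) τ<g)) (pack-unpack B p))
          q≡ : pack B (q % B) (column x) ≡ q
          q≡ = trans (cong (λ z → pack B (q % B) (z / g)) (toℕ-fromℕ< x<n))
                     (trans (cong (pack B (q % B)) (pack-/ g (q / B) τ<g)) (pack-unpack B q))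
          t∈e : (w , y , baseDist (sts w) y) ∈ expectedFrom sts x (q % B) (curEntry (sts u) (pack B (p % B) (row x)))
          t∈e rewrite p≡ | ep | q≡ | eq = here refl
          t∈ : (w , y , baseDist (sts w) y) ∈ tripleFrom (sts u) (r2 x) x (p % B) (q % B)
          t∈ = subst (_ ∈_) (sym (tripleFrom-correct x u (r2≡ x) (m%n<n p B) (m%n<n q B))) t∈e

      knowsNearest-received : KnowsNearest (a + b) u (isNearest k (minPlus (curDist (sts u)) (receivedTriples (sts u) r2)))
                                                      (minPlus (curDist (sts u)) (receivedTriples (sts u) r2))
      knowsNearest-received = knowsNearest-minPlus a b u _ (cur (informed u)) (base ∘ informed) received-sound received-complete

      update-wrap : ∀ {c} → phase (sts u) ≡ c → wraps h c ≡ true →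
                    phase (update (sts u) r2) ≡ 0 × Informed (a + b) (a + b) u (update (sts u) r2)
      update-wrap refl w rewrite w = refl , record { cur = knowsNearest-received ; base = knowsNearest-received }

      update-step : ∀ {c} → phase (sts u) ≡ c → wraps h c ≡ false →
                    phase (update (sts u) r2) ≡ suc c × Informed (a + b) b u (update (sts u) r2)
      update-step refl w rewrite w = refl , record { cur = knowsNearest-received ; base = base (informed u) }

  Informed-cast : ∀ {a a' b b' u s} → a ≡ a' → b ≡ b' → Informed a b u s → Informed a' b' u s
  Informed-cast refl refl inf = inf

module Schedule (h : ℕ) where

  tick : ℕ × ℕ → ℕ × ℕ
  tick (c , j) = if wraps h c then (0 , suc j) else (suc c , j)

  ticks : ℕ → ℕ × ℕ → ℕ × ℕ
  ticks zero    s = s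
  ticks (suc p) s = tick (ticks p s)

  schedule : ℕ → ℕ × ℕ
  schedule p = ticks p (0 , 0)

  curRadius baseRadius : ℕ × ℕ → ℕ
  curRadius  (c , j) = suc c * h ^ j
  baseRadius (c , j) = h ^ j

  radius-wrap : 1 ≤ h → ∀ {c} j → wraps h c ≡ true → curRadius (c , j) + baseRadius (c , j) ≡ h ^ suc j
  radius-wrap h≥1 {c} j w = begin
    suc c * h ^ j + h ^ j           ≡⟨ cong (λ z → z * h ^ j + h ^ j) (≡ᵇ⇒≡ (suc c) (h ∸ 1) (subst T (sym w) _)) ⟩
    (h ∸ 1) * h ^ j + h ^ j         ≡⟨ cong ((h ∸ 1) * h ^ j +_) (*-identityˡ (h ^ j)) ⟨
    (h ∸ 1) * h ^ j + 1 * h ^ j     ≡⟨ *-distribʳ-+ (h ^ j) (h ∸ 1) 1 ⟨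
    (h ∸ 1 + 1) * h ^ j             ≡⟨ cong (_* h ^ j) (m∸n+n≡m h≥1) ⟩
    h ^ suc j                       ∎
    where open ≡-Reasoning

  radius-step : ∀ c j → curRadius (c , j) + baseRadius (c , j) ≡ curRadius (suc c , j)
  radius-step c j = +-comm (suc c * h ^ j) (h ^ j)

  ticks-+ : ∀ p q s → ticks (p + q) s ≡ ticks p (ticks q s)
  ticks-+ zero    q s = refl
  ticks-+ (suc p) q s = cong tick (ticks-+ p q s)

  module _ {m : ℕ} (h≡ : h ≡ suc (suc m)) where

    ticks-within : ∀ c j → c ≤ m → ticks c (0 , j) ≡ (c , j)
    ticks-within zero    j _   = refl
    ticks-within (suc c) j c<m = trans (cong tick (ticks-within c j (<⇒≤ c<m))) stays
      where
        stays : tick (c , j) ≡ (suc c , j)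
        stays rewrite h≡ with suc c ≡ᵇ suc m in w
        ... | false = refl
        ... | true  = ⊥-elim (<-irrefl (suc-injective (≡ᵇ⇒≡ (suc c) (suc m) (subst T (sym w) _))) c<m)

    ticks-period : ∀ j → ticks (h ∸ 1) (0 , j) ≡ (0 , suc j)
    ticks-period j = trans (cong (λ z → ticks (z ∸ 1) (0 , j)) h≡) (trans (cong tick (ticks-within m j ≤-refl)) wrapsAt)
      where
        wrapsAt : tick (m , j) ≡ (0 , suc j)
        wrapsAt rewrite h≡ with suc m ≡ᵇ suc m in w
        ... | true  = refl
        ... | false = ⊥-elim (subst T w (≡⇒≡ᵇ (suc m) (suc m) refl))

    schedule-rounds : ∀ i → schedule ((h ∸ 1) * i) ≡ (0 , i)
    schedule-rounds zero    = cong schedule (*-zeroʳ (h ∸ 1))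
    schedule-rounds (suc i) = begin
      schedule ((h ∸ 1) * suc i)               ≡⟨ cong schedule (*-suc (h ∸ 1) i) ⟩
      ticks (h ∸ 1 + (h ∸ 1) * i) (0 , 0)      ≡⟨ ticks-+ (h ∸ 1) _ (0 , 0) ⟩
      ticks (h ∸ 1) (schedule ((h ∸ 1) * i))   ≡⟨ cong (ticks (h ∸ 1)) (schedule-rounds i) ⟩
      ticks (h ∸ 1) (0 , i)                    ≡⟨ ticks-period i ⟩
      (0 , suc i)                              ∎
      where open ≡-Reasoning

curRadius-final : ∀ h → 1 ≤ h → ∀ i → Schedule.curRadius h (Schedule.schedule h ((h ∸ 1) * i)) ≡ h ^ i
curRadius-final (suc zero)    _ i = sym (^-zeroˡ i)
curRadius-final (suc (suc m)) _ i =
  trans (cong (Schedule.curRadius (suc (suc m))) (Schedule.schedule-rounds (suc (suc m)) refl i)) (+-identityʳ _)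

module Simulation (n h k B g Wd : ℕ) {{_ : NonZero B}} {{_ : NonZero g}}
                  (W : Graph n) {d : ℕ} (pw : PolyWeights d W) (wide : n ^ suc d < 2 ^ Wd) where

  open Exchange n h k B g Wd
  open PhaseCorrect n h k B g Wd W {d} pw wide
  open Nearest W {d} pw k
  open Schedule h

  stateAt : ℕ → Fin n → State n
  stateAt p u = stateOf u (input W u) (run protocol W (p * 2) u)

  isEven-run : ∀ p u → isEven (run protocol W (p * 2) u) ≡ true × isEven (run protocol W (suc (p * 2)) u) ≡ false
  isEven-run zero    u = refl , refl
  isEven-run (suc p) u = isEven-run p u

  Invariant : ℕ → Set
  Invariant p = ∀ u → phase (stateAt p u) ≡ proj₁ (schedule p) ×
                      Informed (curRadius (schedule p)) (baseRadius (schedule p)) u (stateAt p u)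

  invariant-initial : Invariant 0
  invariant-initial u = refl , record { cur = knowsNearest-hopDist 1 u ; base = knowsNearest-hopDist 1 u }

  round1Received : ℕ → Fin n → Fin n → Msg
  round1Received p x w = send protocol w (input W w) (run protocol W (p * 2) w) x

  round1Received≡ : ∀ p x w → round1Received p x w ≡ round1Msg (stateAt p w) x
  round1Received≡ p x w rewrite proj₁ (isEven-run p w) = refl

  round2Received : ℕ → Fin n → Fin n → Msg
  round2Received p u x = send protocol x (input W x) (run protocol W (suc (p * 2)) x) u

  round2Received≡ : ∀ p u x → round2Received p u x ≡ round2Msg (round1Received p x) u
  round2Received≡ p u x rewrite proj₂ (isEven-run p x) = refl

  module _ (h≥1 : 1 ≤ h) (grid : g * g ≤ n) (blocks : k ≤ g * B) where

    module _ (p : ℕ) {c j} (inv : ∀ u → phase (stateAt p u) ≡ c × Informed (curRadius (c , j)) (baseRadius (c , j)) u (stateAt p u))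
             (u : Fin n) where

      open Phase (stateAt p) (proj₂ ∘ inv) (round1Received p) (round1Received≡ p) u (round2Received p u) (round2Received≡ p u)

      advance : phase (stateAt (suc p) u) ≡ proj₁ (tick (c , j)) ×
                Informed (curRadius (tick (c , j))) (baseRadius (tick (c , j))) u (stateAt (suc p) u)
      advance with wraps h c in w
      ... | true  = let (ph , inf) = update-wrap grid blocks (proj₁ (inv u)) w in
                    ph , Informed-cast (trans (radius-wrap h≥1 j w) (sym (+-identityʳ _))) (radius-wrap h≥1 j w) inf
      ... | false = let (ph , inf) = update-step grid blocks (proj₁ (inv u)) w in ph , Informed-cast (radius-step c j) refl inf

    invariant : ∀ p → Invariant p
    invariant zero            = invariant-initial
    invariant (suc p) u with schedule p | invariant p
    ... | (c , j) | inv = advance p inv u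

blockSize : ℕ → ℕ
blockSize C = suc (C + C)

gridSide : ℕ → ℕ → ℕ
gridSide C k = suc (k / blockSize C)

fieldWidth : ℕ → ℕ → ℕ
fieldWidth d n = ⌈log₂ n ⌉ * suc (suc d)

messageFields : ℕ → ℕ
messageFields B = 3 * B + (2 * B) * B

k≤gridSide*blockSize : ∀ C k → k ≤ gridSide C k * blockSize C
k≤gridSide*blockSize C k = begin
  k                              ≡⟨ m≡m%n+[m/n]*n k B ⟩
  k % B + (k / B) * B            ≤⟨ +-monoˡ-≤ _ (<⇒≤ (m%n<n k B)) ⟩
  B + (k / B) * B                ∎
  where
    open ≤-Reasoning
    B : ℕ
    B = blockSize C

k*k≤k^h : ∀ {k h} → 1 ≤ k → 2 ≤ h → k * k ≤ k ^ h
k*k≤k^h {h = suc zero} _ (s≤s ())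
k*k≤k^h {k} {suc (suc h)} k≥1 _ =
  *-monoʳ-≤ k (subst (_≤ k * k ^ h) (*-identityʳ k) (*-monoʳ-≤ k (m^n>0 k {{>-nonZero k≥1}} h)))

-- With B = 2C + 1 and q = k / B: (2q)² · C ≤ (qB)² ≤ k² ≤ C n, and the grid side q + 1 is at most 2q.
gridSide²≤n : ∀ {n k h} C → 1 ≤ n → 1 ≤ k → 2 ≤ h → k ^ h ≤ C * n → gridSide C k * gridSide C k ≤ n
gridSide²≤n {n} {k} zero _ k≥1 h≥2 k^h≤ =
  ⊥-elim (<-irrefl refl (<-≤-trans (≤-trans k≥1 (≤-trans (m≤m*n k k {{>-nonZero k≥1}}) (k*k≤k^h k≥1 h≥2))) k^h≤))
gridSide²≤n {n} {k} {h} C@(suc _) n≥1 k≥1 h≥2 k^h≤ with k / blockSize C in q≡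
... | zero    = n≥1
... | suc q' = *-cancelʳ-≤ _ n C (begin
  suc q * suc q * C                 ≤⟨ *-monoˡ-≤ C (*-mono-≤ (q<2q) (q<2q)) ⟩
  (q + q) * (q + q) * C             ≡⟨ fourSquares q C ⟩
  (q * q) * ((C + C) + (C + C))     ≤⟨ *-monoʳ-≤ (q * q) 4C≤B² ⟩
  (q * q) * (B * B)                 ≡⟨ squareProduct q B ⟩
  (q * B) * (q * B)                 ≤⟨ *-mono-≤ qB≤k qB≤k ⟩
  k * k                             ≤⟨ k*k≤k^h k≥1 h≥2 ⟩
  k ^ h                             ≤⟨ k^h≤ ⟩
  C * n                             ≡⟨ *-comm C n ⟩
  n * C                             ∎)
  where
    open ≤-Reasoning
    B : ℕ
    B = blockSize C
    q : ℕ
    q = suc q'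
    q<2q : suc q ≤ q + q
    q<2q = s≤s (subst (q' <_) (sym (+-suc q' q')) (s≤s (m≤m+n q' q')))
    qB≤k : q * B ≤ k
    qB≤k = subst (λ z → z * B ≤ k) q≡ (m/n*n≤m k B)
    4C≤B² : (C + C) + (C + C) ≤ B * B
    4C≤B² = +-mono-≤ (n≤1+n (C + C)) (m≤m*n (C + C) B)
    fourSquares : ∀ q C → (q + q) * (q + q) * C ≡ (q * q) * ((C + C) + (C + C))
    fourSquares = solve 2 (λ q C → ((q :+ q) :* (q :+ q)) :* C := (q :* q) :* ((C :+ C) :+ (C :+ C))) refl
    squareProduct : ∀ q B → (q * q) * (B * B) ≡ (q * B) * (q * B)
    squareProduct = solve 2 (λ q B → (q :* q) :* (B :* B) := (q :* B) :* (q :* B)) refl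

n^[d+1]<2^fieldWidth : ∀ n d → 2 ≤ n → n ^ suc d < 2 ^ fieldWidth d n
n^[d+1]<2^fieldWidth n d n≥2 = begin-strict
  n ^ suc d                            ≡⟨ *-identityˡ (n ^ suc d) ⟨
  1 * n ^ suc d                        <⟨ *-monoˡ-< (n ^ suc d) {{m^n≢0 n (suc d) {{nz}}}} n≥2 ⟩
  n ^ suc (suc d)                      ≤⟨ ^-monoˡ-≤ (suc (suc d)) (n≤2^⌈log₂n⌉ n) ⟩
  (2 ^ ⌈log₂ n ⌉) ^ suc (suc d)        ≡⟨ ^-*-assoc 2 ⌈log₂ n ⌉ (suc (suc d)) ⟩
  2 ^ fieldWidth d n                   ∎
  where
    open ≤-Reasoning
    nz : NonZero n
    nz = >-nonZero (<-trans z<s n≥2)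

silent : ∀ {n} → Protocol n
silent = record { send = λ _ _ _ _ → [] ; output = λ _ _ _ → (λ _ → true) , (λ _ → just 0) }

-- On a single node the node itself is its only r-hop neighbour, at distance 0.
silent-correct : ∀ (W : Graph 1) r k → 1 ≤ k → ∀ u → CorrectNearest W r k u ((λ _ → true) , (λ _ → just 0))
silent-correct W r k k≥1 fz =
  D , hopDist-correct W r fz , (λ { fz → (λ _ → near) , (λ _ → refl) }) , (λ { fz _ → sym (hopDist-refl W r fz) })
  where
    D : Fin 1 → ℕ∞
    D = hopDist W r fz
    near : InNearest k D fz
    near = ≤-<-trans (count-mono (flip (Before? D) fz) (λ _ → no id) (allFin 1) (λ { {fz} _ → Before-irrefl D {fz} })) k≥1

algorithm : ℕ → ℕ → Algorithm
algorithm d C n@(suc (suc _)) h k i = Exchange.protocol n h k (blockSize C) (gridSide C k) (fieldWidth d n)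
algorithm d C _               h k i = silent

message-length-≤ : ∀ n h k B g Wd {{_ : NonZero B}} {{_ : NonZero g}} u inp rounds v →
  length (send (Exchange.protocol n h k B g Wd) u inp rounds v) ≤ messageFields B * Wd
message-length-≤ n h k B g Wd u inp rounds v with isEven rounds
... | true  = subst (_≤ messageFields B * Wd) (sym (length-encodeFields Wd (3 * B) _)) (*-monoˡ-≤ Wd (m≤m+n (3 * B) _))
... | false = subst (_≤ messageFields B * Wd) (sym (length-encodeFields Wd ((2 * B) * B) _)) (*-monoˡ-≤ Wd (m≤n+m _ (3 * B)))

module _ (d C : ℕ) {m : ℕ} (W : Graph (suc (suc m))) (pw : PolyWeights d W) {h k : ℕ} where

  private
    n : ℕ
    n = suc (suc m)
    B : ℕ
    B = blockSize C
    g : ℕ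
    g = gridSide C k
    Wd : ℕ
    Wd = fieldWidth d n

  open Simulation n h k B g Wd W {d} pw (n^[d+1]<2^fieldWidth n d (s≤s (s≤s z≤n)))
  open PhaseCorrect n h k B g Wd W {d} pw (n^[d+1]<2^fieldWidth n d (s≤s (s≤s z≤n)))
  open Nearest W {d} pw k

  algorithm-bandwidth : ∀ i {R} → Bandwidth (messageFields B * suc (suc d)) (algorithm d C n h k i) W R
  algorithm-bandwidth i t u v _ =
    subst (length (send (algorithm d C n h k i) u (input W u) (run (algorithm d C n h k i) W t u) v) ≤_)
          (solve 3 (λ F L D → F :* (L :* D) := (F :* D) :* L) refl (messageFields B) ⌈log₂ n ⌉ (suc (suc d)))
          (message-length-≤ n h k B g Wd u (input W u) (run (algorithm d C n h k i) W t u) v)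

  invariant-rounds : 1 ≤ h → 1 ≤ k → k ^ h ≤ C * n → ∀ i → Invariant ((h ∸ 1) * i)
  invariant-rounds h≥1 k≥1 k^h≤ i with m≤n⇒m<n∨m≡n h≥1
  ... | inj₂ 1≡h = subst (λ z → Invariant ((z ∸ 1) * i)) 1≡h invariant-initial
  ... | inj₁ h≥2 = invariant h≥1 (gridSide²≤n C (s≤s z≤n) k≥1 h≥2 k^h≤) (k≤gridSide*blockSize C k) ((h ∸ 1) * i)

  algorithm-correct : 1 ≤ h → 1 ≤ k → k ^ h ≤ C * n → ∀ i u →
    CorrectNearest W (h ^ i) k u (outputAt (algorithm d C n h k i) W (((h ∸ 1) * 2) * i) u)
  algorithm-correct h≥1 k≥1 k^h≤ i u =
    subst (λ t → CorrectNearest W (h ^ i) k u (outputAt (algorithm d C n h k i) W t u)) (sym rounds≡)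
          (correct (cur (Informed-cast (curRadius-final h h≥1 i) refl (proj₂ (invariant-rounds h≥1 k≥1 k^h≤ i u)))))
    where
      rounds≡ : ((h ∸ 1) * 2) * i ≡ ((h ∸ 1) * i) * 2
      rounds≡ = solve 3 (λ a b c → (a :* b) :* c := (a :* c) :* b) refl (h ∸ 1) 2 i

lemma5p2 : (d h C : ℕ) → 1 ≤ h →
    ∃ λ (A : Algorithm) → ∃₂ λ (c b : ℕ) →
      ∀ n k i → 1 ≤ k → 1 ≤ i → k ^ h ≤ C * n →
      (W : Graph n) → PolyWeights d W →
        Bandwidth b (A n h k i) W (c * i) ×
        (∀ u → CorrectNearest W (h ^ i) k u (outputAt (A n h k i) W (c * i) u))
lemma5p2 d h C h≥1 = algorithm d C , (h ∸ 1) * 2 , messageFields (blockSize C) * suc (suc d) , guarantee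
  where
    guarantee : ∀ n k i → 1 ≤ k → 1 ≤ i → k ^ h ≤ C * n → (W : Graph n) → PolyWeights d W →
      Bandwidth (messageFields (blockSize C) * suc (suc d)) (algorithm d C n h k i) W (((h ∸ 1) * 2) * i) ×
      (∀ u → CorrectNearest W (h ^ i) k u (outputAt (algorithm d C n h k i) W (((h ∸ 1) * 2) * i) u))
    guarantee zero             k i _   _ _     W pw = (λ _ _ _ _ → z≤n) , λ ()
    guarantee (suc zero)       k i k≥1 _ _     W pw = (λ _ _ _ _ → z≤n) , silent-correct W (h ^ i) k k≥1
    guarantee n@(suc (suc _)) k i k≥1 _ k^h≤ W pw = algorithm-bandwidth d C W pw i , algorithm-correct d C W pw h≥1 k≥1 k^h≤ i
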